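{- For every stack partition $\tau=(d_1^{m_1},\dots,d_s^{m_s})\Vdash n$, \[ H^+_\tau=\sum_{\alpha\Vdash n}\mathbf{HS}^\tau_\alpha M_\alpha, \qquad \mathbf{HS}^\tau_\alpha=\sum_{(\sigma_1,\dots,\sigma_s)}\Big(\prod_{i=1}^s(-1)^{\operatorname{area}(\sigma_i)}\Big)\mathcal S^\alpha_{(\sigma_1^{m_1},\dots,\sigma_s^{m_s})}, \] where the sum is over all tuples of stack partitions $\sigma_i\Vdash d_i$.
   Context: Polysymmetric functions are formal power series of bounded degree in variables $x_{i,j}$ ($i,j\ge1$), $x_{i,j}$ of degree $i$, invariant under permutations of $x_{i,1},x_{i,2},\dots$ for each fixed $i$. A stack is a pair of positive integers $d^m$; a stack partition $\tau\Vdash n$ is a finite weakly decreasing sequence of stacks $(d_1^{m_1},\dots,d_s^{m_s})$ (ordered by $d^m\ge d'^{m'}$ iff $d>d'$, or $d=d'$ and $m\ge m'$) with $\sum d_im_i=n$; $\operatorname{area}(\tau)=\sum m_i$. For a stack partition $\sigma$ and positive integer $m$, $\sigma^m$ is obtained by multiplying every multiplicity of $\sigma$ by $m$. $M_\tau=\sum_\alpha x_{d_1,\alpha_1}^{m_1}\cdots x_{d_s,\alpha_s}^{m_s}$ over sequences $\alpha$ of positive integers with $\alpha_i\ne\alpha_j$ whenever $d_i=d_j$, $i\ne j$. $H^+_d=\sum_{\sigma\Vdash d}(-1)^{\operatorname{area}(\sigma)}M_\sigma$; $H^+_{d^m}$ is $H^+_d$ with each $x_{i,j}$ replaced by $x_{i,j}^m$;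 $H^+_\tau=\prod_iH^+_{d_i^{m_i}}$. For $u\ge1$, $\tau|_u$ is the weakly decreasing sequence of multiplicities of the degree-$u$ stacks of $\tau$. For a sequence $\boldsymbol\beta=(\beta_1,\dots,\beta_r)$ of stack partitions and a stack partition $\alpha$, $s^\alpha_{\boldsymbol\beta}(u)$ is the number of $r\times\ell(\alpha|_u)$ nonnegative integer matrices whose $i$th row is a rearrangement of $\beta_i|_u$ padded with zeros to length $\ell(\alpha|_u)$ and whose column sums equal $\alpha|_u$ ($0$ if some $\ell(\beta_i|_u)>\ell(\alpha|_u)$; $1$ if all are empty), and $\mathcal S^\alpha_{\boldsymbol\beta}=\prod_{u\ge1}s^\alpha_{\boldsymbol\beta}(u)$. -}

module Defs where

open import Data.Nat as ℕ using (ℕ; zero; suc; _+_; _*_; _∸_; _≡ᵇ_; _≤ᵇ_; _<ᵇ_)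
open import Data.Nat.DivMod using (_/_; _%_)
open import Data.Integer as ℤ using (ℤ; +_; -_)
open import Data.Bool using (Bool; true; false; _∧_; _∨_; if_then_else_; not)
open import Data.List as L using (List; []; _∷_; _++_; map; concatMap; filterᵇ; upTo; length; replicate; zipWith; foldr)
open import Data.Nat.ListAction using (sum; product)
import Data.List.Properties as LP
open import Data.Vec as V using (Vec)
open import Data.Product using (_×_; _,_; proj₁; proj₂)
import Data.Product.Properties as PP
open import Data.Fin using (Fin; toℕ)
open import Relation.Nullary.Decidable using (⌊_⌋)

-- Stacks and stack partitions
-- A stack d^m is the pair (d , m) : degree d, multiplicity m.

Stack : Set
Stack = ℕ × ℕ

-- A stack partition is a list of stacks (intended weakly decreasing).
SP : Set
SP = List Stack

_≥ˢ_ : Stack → Stack → Bool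
(d , m) ≥ˢ (d' , m') = (d' <ᵇ d) ∨ ((d ≡ᵇ d') ∧ (m' ≤ᵇ m))

sortedDesc : SP → Bool
sortedDesc [] = true
sortedDesc (x ∷ []) = true
sortedDesc (x ∷ y ∷ r) = (x ≥ˢ y) ∧ sortedDesc (y ∷ r)

positiveStacks : SP → Bool
positiveStacks [] = true
positiveStacks ((d , m) ∷ r) = (1 ≤ᵇ d) ∧ (1 ≤ᵇ m) ∧ positiveStacks r

weight : SP → ℕ
weight τ = sum (map (λ { (d , m) → d * m }) τ)

area : SP → ℕ
area τ = sum (map proj₂ τ)

isStackPartition : ℕ → SP → Bool
isStackPartition n τ = positiveStacks τ ∧ sortedDesc τ ∧ (weight τ ≡ᵇ n)

upTo1 : ℕ → List ℕ
upTo1 n = map suc (upTo n)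

listsOfLength : {A : Set} → ℕ → List A → List (List A)
listsOfLength zero xs = [] ∷ []
listsOfLength (suc k) xs = concatMap (λ x → map (x ∷_) (listsOfLength k xs)) xs

stacksUpTo : ℕ → List Stack
stacksUpTo n = concatMap (λ d → map (d ,_) (upTo1 n)) (upTo1 n)

-- The list of all stack partitions of n, each exactly once.
-- (Every τ ⊩ n has length ≤ n and all d_i, m_i ≤ n.)
stackPartitions : ℕ → List SP
stackPartitions n =
  filterᵇ (isStackPartition n)
          (concatMap (λ k → listsOfLength k (stacksUpTo n)) (upTo (suc n)))

_^ˢ_ : SP → ℕ → SP
σ ^ˢ m = map (λ { (d , k) → (d , m * k) }) σ

insertℕ : ℕ → List ℕ → List ℕ
insertℕ x [] = x ∷ []
insertℕ x (y ∷ ys) = if y ≤ᵇ x then x ∷ y ∷ ys else y ∷ insertℕ x ys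

sortDescℕ : List ℕ → List ℕ
sortDescℕ = foldr insertℕ []

insertˢ : Stack → SP → SP
insertˢ x [] = x ∷ []
insertˢ x (y ∷ ys) = if x ≥ˢ y then x ∷ y ∷ ys else y ∷ insertˢ x ys

sortSP : SP → SP
sortSP = foldr insertˢ []

_==ℕs_ : List ℕ → List ℕ → Bool
xs ==ℕs ys = ⌊ LP.≡-dec ℕ._≟_ xs ys ⌋

_==SP_ : SP → SP → Bool
xs ==SP ys = ⌊ LP.≡-dec (PP.≡-dec ℕ._≟_ ℕ._≟_) xs ys ⌋

-- We work with the finitely many variables x_{u,j}, 1 ≤ u ≤ D, 1 ≤ j ≤ N.
-- A monomial is its exponent array: row i (i : Fin D) holds the exponents
-- of x_{u,1},…,x_{u,N} where u = toℕ i + 1.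
-- Every monomial in the variables x_{i,j} arises this way for some D, N,
-- and its coefficient in a series equals its coefficient after setting all
-- other variables to 0; so a series is determined by these coefficients.

Mono : ℕ → ℕ → Set
Mono D N = Vec (Vec ℕ N) D

Series : ℕ → ℕ → Set
Series D N = Mono D N → ℤ

sumℤ : List ℤ → ℤ
sumℤ = foldr ℤ._+_ (+ 0)

sign : ℕ → ℤ
sign zero = + 1
sign (suc k) = - sign k

rowsWithDegree : ∀ {D N} → Mono D N → List (ℕ × Vec ℕ N)
rowsWithDegree {D} e = V.toList (V.zip (V.tabulate (λ (i : Fin D) → suc (toℕ i))) e)

monoType : ∀ {D N} → Mono D N → SP
monoType e =
  sortSP (concatMap (λ { (u , row) → map (u ,_) (filterᵇ (λ k → 1 ≤ᵇ k) (V.toList row)) })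
                    (rowsWithDegree e))

-- M_α : the sum of all distinct monomials of type α
coeffM : ∀ {D N} → SP → Series D N
coeffM α e = if monoType e ==SP α then + 1 else + 0

splitsV : ∀ {n} → Vec ℕ n → List (Vec ℕ n × Vec ℕ n)
splitsV V.[] = (V.[] , V.[]) ∷ []
splitsV (k V.∷ v) =
  concatMap (λ i → map (λ { (a , b) → (i V.∷ a , (k ∸ i) V.∷ b) }) (splitsV v)) (upTo (suc k))

splitsM : ∀ {D N} → Mono D N → List (Mono D N × Mono D N)
splitsM V.[] = (V.[] , V.[]) ∷ []
splitsM (r V.∷ e) =
  concatMap (λ { (a , b) → map (λ { (as , bs) → (a V.∷ as , b V.∷ bs) }) (splitsM e) }) (splitsV r)

mulS : ∀ {D N} → Series D N → Series D N → Series D N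
mulS f g e = sumℤ (map (λ { (a , b) → f a ℤ.* g b }) (splitsM e))

allZero : ∀ {D N} → Mono D N → Bool
allZero e = L.all (λ row → L.all (λ k → k ≡ᵇ 0) (V.toList row)) (V.toList e)

oneS : ∀ {D N} → Series D N
oneS e = if allZero e then + 1 else + 0

-- substitution x_{i,j} ↦ x_{i,j}^m (only used with m ≥ 1)
powSub : ∀ {D N} → ℕ → Series D N → Series D N
powSub zero f e = + 0
powSub (suc k) f e =
  if L.all (λ row → L.all (λ x → (x % suc k) ≡ᵇ 0) (V.toList row)) (V.toList e)
  then f (V.map (V.map (λ x → x / suc k)) e)
  else + 0

Hplus : ∀ {D N} → ℕ → Series D N
Hplus d e = sumℤ (map (λ σ → sign (area σ) ℤ.* coeffM σ e) (stackPartitions d))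

HplusSP : ∀ {D N} → SP → Series D N
HplusSP τ = foldr (λ { (d , m) acc → mulS (powSub m (Hplus d)) acc }) oneS τ

restrict : ℕ → SP → List ℕ
restrict u τ = sortDescℕ (map proj₂ (filterᵇ (λ s → proj₁ s ≡ᵇ u) τ))

cartesian : {A : Set} → List (List A) → List (List A)
cartesian [] = [] ∷ []
cartesian (xs ∷ xss) = concatMap (λ x → map (x ∷_) (cartesian xss)) xs

rowCandidates : ℕ → List ℕ → List (List ℕ)
rowCandidates L b =
  filterᵇ (λ v → sortDescℕ v ==ℕs sortDescℕ (b ++ replicate (L ∸ length b) 0))
          (listsOfLength L (upTo (suc (sum b))))

columnSums : ℕ → List (List ℕ) → List ℕ
columnSums L rows = foldr (zipWith _+_) (replicate L 0) rows

sCount : SP → List SP → ℕ → ℕ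
sCount α βs u =
  let a = restrict u α
      L = length a
  in length (filterᵇ (λ rows → columnSums L rows ==ℕs a)
                     (cartesian (map (λ β → rowCandidates L (restrict u β)) βs)))

degSum : SP → ℕ
degSum τ = sum (map proj₁ τ)

-- 𝒮^α_β = ∏_{u ≥ 1} s^α_β(u); factors with u larger than every degree
-- occurring in α or β equal 1, so the product is over u = 1 … B.
calS : SP → List SP → ℕ
calS α βs = product (map (sCount α βs) (upTo1 (degSum α + sum (map degSum βs))))

HS : SP → SP → ℤ
HS τ α =
  sumℤ (map (λ σs → foldr ℤ._*_ (+ 1) (map (λ σ → sign (area σ)) σs)
                     ℤ.* + calS α (zipWith (λ { (d , m) σ → σ ^ˢ m }) τ σs))
            (cartesian (map (λ { (d , m) → stackPartitions d }) τ)))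

-- Multiplying out H⁺_τ = ∏ᵢ H⁺_{dᵢ^mᵢ}, and using that the substitution x ↦ xᵐ sends M_σ to M_{σᵐ},
-- H⁺_τ is the signed sum over tuples σᵢ ⊩ dᵢ of the products M_{σ₁^m₁} ⋯ M_{σₛ^mₛ}.  So it suffices that
-- the coefficient of a monomial of type α in M_{β₁} ⋯ M_{βᵣ} is 𝒮^α_β.  That coefficient counts the ways
-- to write the exponent matrix of the monomial as a sum of exponent matrices of types β₁, …, βᵣ, and this
-- factorises over the rows, i.e. over the degrees u: row u has to be split into r rows, the i-th a
-- rearrangement of βᵢ|_u padded with zeros.  The number of such splittings is a convolution of
-- rearrangement indicators; it does not see zero entries or the order of the row, so it depends only on
-- α|_u, and it is exactly the matrix count s^α_β(u).  Monomials whose weight is not n contribute to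
-- neither side.

module Submission where

open import Defs
open import Algebra.Bundles using (CommutativeSemiring; CommutativeMonoid)
import Algebra.Properties.CommutativeSemigroup as CommSemigroupProps
open import Data.Bool using (Bool; true; false; T; _∧_; not; if_then_else_)
import Data.Bool.ListAction as Bool
open import Data.Bool.Properties using (T-∧; T-∨; ∧-commutativeMonoid)
open import Data.Empty using (⊥-elim)
open import Data.Fin using (Fin; toℕ)
import Data.Fin as Fin
open import Data.Integer using (ℤ; +_) renaming (_*_ to _*ℤ_; _+_ to _+ℤ_)
import Data.Integer.Properties as ℤP
open import Data.List as L
  using (List; []; _∷_; _++_; map; concatMap; filterᵇ; upTo; length; replicate; zipWith; foldr; applyUpTo)
import Data.List.Properties as LP
open import Data.List.Relation.Binary.Permutation.Propositional as ↭
  using (_↭_; ↭-refl; ↭-sym; ↭-trans; ↭-reflexive; ↭-prep; ↭-swap; ↭⇒↭ₛ′)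
import Data.List.Relation.Binary.Permutation.Propositional.Properties as Perm
open import Data.List.Relation.Binary.Pointwise using (Pointwise-≡⇒≡)
open import Data.List.Relation.Unary.All as All using (All; []; _∷_)
import Data.List.Relation.Unary.Linked as Linked
import Data.List.Relation.Unary.All.Properties as AllP
import Data.Nat as ℕ
import Data.Nat.Properties as ℕP
open import Data.Nat.DivMod using (_/_; _%_; m≡m%n+[m/n]*n; m*n%n≡0)
open import Data.Nat.ListAction using (sum; product)
import Data.Nat.ListAction.Properties as ℕLP
open import Data.Product using (_×_; _,_; proj₁; proj₂)
import Data.Product.Properties as ×P
open import Data.Sum as Sum using (_⊎_; inj₁; inj₂)
open import Data.Unit using (tt)
open import Data.Vec as V using (Vec)
open import Function using (_∘_; Equivalence)
open import Level using (0ℓ)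
open import Relation.Binary.Core using (Rel; _Preserves_⟶_)
open import Relation.Binary.Bundles using (DecTotalOrder)
open import Relation.Binary.Definitions using (Tri; tri<; tri≈; tri>)
open import Relation.Binary.PropositionalEquality
  using (_≡_; _≢_; refl; sym; trans; cong; cong₂; subst; isEquivalence; module ≡-Reasoning)
open import Relation.Binary.Structures using (IsDecTotalOrder)
import Relation.Binary.Construct.Flip.EqAndOrd as Flip
open import Relation.Nullary using (¬_; Dec; yes; no)
open import Relation.Nullary.Decidable using (toWitness; fromWitness; T?)

module ListSum {c ℓ} (R : CommutativeSemiring c ℓ) where
  open CommutativeSemiring R renaming (refl to ≈-refl; sym to ≈-sym; trans to ≈-trans)

  ∑ : {A : Set} → List A → (A → Carrier) → Carrier
  ∑ xs f = foldr _+_ 0# (map f xs)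

  module _ {A : Set} where
    ∑-++ : (xs ys : List A) (f : A → Carrier) → ∑ (xs ++ ys) f ≈ ∑ xs f + ∑ ys f
    ∑-++ [] ys f = ≈-sym (+-identityˡ _)
    ∑-++ (x ∷ xs) ys f = ≈-trans (+-congˡ (∑-++ xs ys f)) (≈-sym (+-assoc _ _ _))

    ∑-cong : (xs : List A) {f g : A → Carrier} → (∀ x → f x ≈ g x) → ∑ xs f ≈ ∑ xs g
    ∑-cong [] f≈g = ≈-refl
    ∑-cong (x ∷ xs) f≈g = +-cong (f≈g x) (∑-cong xs f≈g)

    ∑-cong-All : {P : A → Set} {xs : List A} {f g : A → Carrier} →
                 All P xs → (∀ {x} → P x → f x ≈ g x) → ∑ xs f ≈ ∑ xs g
    ∑-cong-All [] f≈g = ≈-refl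
    ∑-cong-All (px ∷ pxs) f≈g = +-cong (f≈g px) (∑-cong-All pxs f≈g)

    ∑-zero : (xs : List A) {f : A → Carrier} → (∀ x → f x ≈ 0#) → ∑ xs f ≈ 0#
    ∑-zero [] f≈0 = ≈-refl
    ∑-zero (x ∷ xs) f≈0 = ≈-trans (+-cong (f≈0 x) (∑-zero xs f≈0)) (+-identityˡ 0#)

    ∑-+ : (xs : List A) (f g : A → Carrier) → ∑ xs (λ x → f x + g x) ≈ ∑ xs f + ∑ xs g
    ∑-+ [] f g = ≈-sym (+-identityˡ 0#)
    ∑-+ (x ∷ xs) f g = ≈-trans (+-congˡ (∑-+ xs f g)) (interchange (f x) (g x) (∑ xs f) (∑ xs g))
      where open CommSemigroupProps (CommutativeMonoid.commutativeSemigroup +-commutativeMonoid) using (interchange)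

    ∑-*ˡ : (k : Carrier) (xs : List A) (f : A → Carrier) → k * ∑ xs f ≈ ∑ xs (λ x → k * f x)
    ∑-*ˡ k [] f = zeroʳ k
    ∑-*ˡ k (x ∷ xs) f = ≈-trans (distribˡ k (f x) _) (+-congˡ (∑-*ˡ k xs f))

    ∑-*ʳ : (k : Carrier) (xs : List A) (f : A → Carrier) → ∑ xs f * k ≈ ∑ xs (λ x → f x * k)
    ∑-*ʳ k xs f = ≈-trans (*-comm _ k) (≈-trans (∑-*ˡ k xs f) (∑-cong xs (λ x → *-comm k (f x))))

    ∑-filterᵇ : (p : A → Bool) (xs : List A) (f : A → Carrier) →
                ∑ (filterᵇ p xs) f ≈ ∑ xs (λ x → if p x then f x else 0#)
    ∑-filterᵇ p [] f = ≈-refl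
    ∑-filterᵇ p (x ∷ xs) f with p x
    ... | true = +-congˡ (∑-filterᵇ p xs f)
    ... | false = ≈-trans (∑-filterᵇ p xs f) (≈-sym (+-identityˡ _))

  module _ {A B : Set} where
    ∑-map : (g : A → B) (xs : List A) (f : B → Carrier) → ∑ (map g xs) f ≈ ∑ xs (f ∘ g)
    ∑-map g [] f = ≈-refl
    ∑-map g (x ∷ xs) f = +-congˡ (∑-map g xs f)

    ∑-concatMap : (g : A → List B) (xs : List A) (f : B → Carrier) →
                  ∑ (concatMap g xs) f ≈ ∑ xs (λ x → ∑ (g x) f)
    ∑-concatMap g [] f = ≈-refl
    ∑-concatMap g (x ∷ xs) f = ≈-trans (∑-++ (g x) _ f) (+-congˡ (∑-concatMap g xs f))

    ∑-comm : (xs : List A) (ys : List B) (f : A → B → Carrier) →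
             ∑ xs (λ x → ∑ ys (f x)) ≈ ∑ ys (λ y → ∑ xs (λ x → f x y))
    ∑-comm [] ys f = ≈-sym (∑-zero ys (λ _ → ≈-refl))
    ∑-comm (x ∷ xs) ys f = ≈-trans (+-congˡ (∑-comm xs ys f)) (≈-sym (∑-+ ys (f x) _))

  module _ {A : Set} where
    ∑-listsOfLength-suc : ∀ n (S : List A) (h : List A → Carrier) →
      ∑ (listsOfLength (ℕ.suc n) S) h ≈ ∑ S (λ i → ∑ (listsOfLength n S) (λ x → h (i ∷ x)))
    ∑-listsOfLength-suc n S h =
      ≈-trans (∑-concatMap _ S h) (∑-cong S (λ i → ∑-map (i ∷_) (listsOfLength n S) h))

    ∑-cartesian-∷ : (xs : List A) (xss : List (List A)) (h : List A → Carrier) →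
      ∑ (cartesian (xs ∷ xss)) h ≈ ∑ xs (λ x → ∑ (cartesian xss) (λ ys → h (x ∷ ys)))
    ∑-cartesian-∷ xs xss h =
      ≈-trans (∑-concatMap _ xs h) (∑-cong xs (λ x → ∑-map (x ∷_) (cartesian xss) h))

open ℕ using (ℕ; zero; suc; _+_; _*_; _∸_; _≡ᵇ_; _≤ᵇ_; _<ᵇ_; _≤_; _<_; z≤n; s≤s)

module ℕΣ = ListSum ℕP.+-*-commutativeSemiring
module ℤΣ = ListSum ℤP.+-*-commutativeSemiring
open ℕΣ using (∑)

T-ext : ∀ {b c} → (T b → T c) → (T c → T b) → b ≡ c
T-ext {false} {false} _ _ = refl
T-ext {false} {true} _ c⇒b = ⊥-elim (c⇒b tt)
T-ext {true} {false} b⇒c _ = ⊥-elim (b⇒c tt)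
T-ext {true} {true} _ _ = refl

≡true⇒T : ∀ {b} → b ≡ true → T b
≡true⇒T refl = tt

¬T⇒≡false : ∀ {b} → ¬ T b → b ≡ false
¬T⇒≡false {false} _ = refl
¬T⇒≡false {true} ¬t = ⊥-elim (¬t tt)

T⇒≡true : ∀ {b} → T b → b ≡ true
T⇒≡true {true} _ = refl

T-∧⁺ : ∀ {b c} → T b → T c → T (b ∧ c)
T-∧⁺ tb tc = Equivalence.from T-∧ (tb , tc)

T-∧⁻ : ∀ {b c} → T (b ∧ c) → T b × T c
T-∧⁻ = Equivalence.to T-∧

T-not-≡ᵇ⇒≢ : ∀ {m n} → T (not (m ≡ᵇ n)) → m ≢ n
T-not-≡ᵇ⇒≢ {m} h refl = subst (T ∘ not) (T⇒≡true (ℕP.≡⇒≡ᵇ m m refl)) h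

≢⇒T-not-≡ᵇ : ∀ {m n} → m ≢ n → T (not (m ≡ᵇ n))
≢⇒T-not-≡ᵇ {m} {n} m≢n = subst (T ∘ not) (sym (¬T⇒≡false (m≢n ∘ ℕP.≡ᵇ⇒≡ m n))) tt

ind : Bool → ℕ
ind b = if b then 1 else 0

ind-∧ : ∀ a b → ind (a ∧ b) ≡ ind a * ind b
ind-∧ true b = sym (ℕP.+-identityʳ _)
ind-∧ false b = refl

if-then-0 : ∀ b n → (if b then n else 0) ≡ ind b * n
if-then-0 true n = sym (ℕP.+-identityʳ n)
if-then-0 false n = refl

indℤ : ∀ b → (if b then + 1 else + 0) ≡ + ind b
indℤ true = refl
indℤ false = refl

==ℕs⇒≡ : ∀ {xs ys} → T (xs ==ℕs ys) → xs ≡ ys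
==ℕs⇒≡ = toWitness

≡⇒==ℕs : ∀ {xs ys} → xs ≡ ys → T (xs ==ℕs ys)
≡⇒==ℕs = fromWitness

==SP⇒≡ : ∀ {xs ys} → T (xs ==SP ys) → xs ≡ ys
==SP⇒≡ = toWitness

≡⇒==SP : ∀ {xs ys} → xs ≡ ys → T (xs ==SP ys)
≡⇒==SP = fromWitness

*-interchange : ∀ a b c d → (a * b) * (c * d) ≡ (a * c) * (b * d)
*-interchange = CommSemigroupProps.interchange ℕP.*-commutativeSemigroup

x*[y*z]≡y*[x*z] : ∀ x y z → x * (y * z) ≡ y * (x * z)
x*[y*z]≡y*[x*z] = CommSemigroupProps.x∙yz≈y∙xz ℕP.*-commutativeSemigroup

+-interchange : ∀ a b c d → (a + b) + (c + d) ≡ (a + c) + (b + d)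
+-interchange = CommSemigroupProps.interchange ℕP.+-commutativeSemigroup

∑-upTo-suc : ∀ n (f : ℕ → ℕ) → ∑ (upTo (suc n)) f ≡ ∑ (upTo n) f + f n
∑-upTo-suc n f = trans (cong (λ l → ∑ l f) (sym (LP.upTo-∷ʳ n)))
  (trans (ℕΣ.∑-++ (upTo n) (n ∷ []) f) (cong (_+_ (∑ (upTo n) f)) (ℕP.+-identityʳ (f n))))

∑-upTo-truncate : ∀ {n m} (f : ℕ → ℕ) → n ℕ.≤′ m → (∀ i → n ≤ i → f i ≡ 0) → ∑ (upTo m) f ≡ ∑ (upTo n) f
∑-upTo-truncate f ℕ.≤′-refl _ = refl
∑-upTo-truncate f (ℕ.≤′-step {m} n≤′m) f0 =
  trans (∑-upTo-suc m f) (trans (cong₂ _+_ (∑-upTo-truncate f n≤′m f0) (f0 m (ℕP.≤′⇒≤ n≤′m))) (ℕP.+-identityʳ _))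

length-filterᵇ : ∀ {A : Set} (p : A → Bool) xs → length (filterᵇ p xs) ≡ ∑ xs (ind ∘ p)
length-filterᵇ p [] = refl
length-filterᵇ p (x ∷ xs) with p x
... | true = cong suc (length-filterᵇ p xs)
... | false = length-filterᵇ p xs

filterᵇ-filterᵇ : ∀ {A : Set} {p q : A → Bool} → (∀ x → T (p x) → T (q x)) →
                  ∀ xs → filterᵇ p (filterᵇ q xs) ≡ filterᵇ p xs
filterᵇ-filterᵇ p⇒q [] = refl
filterᵇ-filterᵇ {p = p} {q} p⇒q (x ∷ xs) with q x in qx
... | true with p x
...   | true = cong (x ∷_) (filterᵇ-filterᵇ p⇒q xs)
...   | false = filterᵇ-filterᵇ p⇒q xs
filterᵇ-filterᵇ {p = p} {q} p⇒q (x ∷ xs) | false with p x in px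
...   | false = filterᵇ-filterᵇ p⇒q xs
...   | true = ⊥-elim (subst T qx (p⇒q x (≡true⇒T px)))

↭-filterᵇ-partition : ∀ {A : Set} (p : A → Bool) xs → xs ↭ filterᵇ p xs ++ filterᵇ (not ∘ p) xs
↭-filterᵇ-partition p [] = ↭-refl
↭-filterᵇ-partition p (x ∷ xs) with p x
... | true = ↭-prep x (↭-filterᵇ-partition p xs)
... | false = ↭-trans (↭-prep x (↭-filterᵇ-partition p xs)) (↭-sym (Perm.shift x (filterᵇ p xs) _))

null-partition : ∀ {A : Set} (p : A → Bool) xs →
  ind (L.null (filterᵇ p xs)) * ind (L.null (filterᵇ (not ∘ p) xs)) ≡ ind (L.null xs)
null-partition p [] = refl
null-partition p (x ∷ xs) with p x
... | true = refl
... | false = ℕP.*-zeroʳ (ind (L.null (filterᵇ p xs)))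

All-≤-sum : ∀ b → All (_≤ sum b) b
All-≤-sum [] = []
All-≤-sum (y ∷ b) = ℕP.m≤m+n y (sum b) ∷ All.map (λ p → ℕP.≤-trans p (ℕP.m≤n+m (sum b) y)) (All-≤-sum b)

product-map-cong-All : ∀ {A : Set} {P : A → Set} {xs} {f g : A → ℕ} → All P xs → (∀ {x} → P x → f x ≡ g x) →
  product (map f xs) ≡ product (map g xs)
product-map-cong-All [] f≡g = refl
product-map-cong-All (px ∷ pxs) f≡g = cong₂ _*_ (f≡g px) (product-map-cong-All pxs f≡g)

product-map-1 : ∀ {A : Set} {f : A → ℕ} {xs} → All ((_≡ 1) ∘ f) xs → product (map f xs) ≡ 1
product-map-1 [] = refl
product-map-1 (fx≡1 ∷ fxs≡1) = cong₂ _*_ fx≡1 (product-map-1 fxs≡1)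

listsOfLength-length : ∀ {A : Set} n (S : List A) → All (λ x → length x ≡ n) (listsOfLength n S)
listsOfLength-length zero S = refl ∷ []
listsOfLength-length (suc n) S =
  AllP.concat⁺ (AllP.map⁺ (All.universal (λ x → AllP.map⁺ (All.map (cong suc) (listsOfLength-length n S))) S))

cartesian-All : ∀ {A : Set} {P : A → Set} {xss} → All (All P) xss → All (All P) (cartesian xss)
cartesian-All [] = [] ∷ []
cartesian-All (pxs ∷ pxss) =
  AllP.concat⁺ (AllP.map⁺ (All.map (λ px → AllP.map⁺ (All.map (px ∷_) (cartesian-All pxss))) pxs))

module SortedPermutation {A : Set} {_≤_ : Rel A 0ℓ} (isDecTotalOrder : IsDecTotalOrder _≡_ _≤_) where
  order : DecTotalOrder 0ℓ 0ℓ 0ℓ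
  order = record { isDecTotalOrder = isDecTotalOrder }

  open DecTotalOrder order using (totalOrder; module Eq)
  open import Data.List.Relation.Unary.Sorted.TotalOrder totalOrder public using (Sorted)
  open import Data.List.Relation.Unary.Sorted.TotalOrder.Properties using (↗↭↗⇒≋; map⁺)
  open import Data.List.Sort.InsertionSort.Base order public using (insert; sort)
  open import Data.List.Sort.InsertionSort.Properties order public using (sort-↭; sort-↗)

  sorted-↭-unique : ∀ {xs ys} → Sorted xs → Sorted ys → xs ↭ ys → xs ≡ ys
  sorted-↭-unique xs↗ ys↗ xs↭ys =
    Pointwise-≡⇒≡ (↗↭↗⇒≋ totalOrder xs↗ ys↗ (↭⇒↭ₛ′ Eq.isEquivalence xs↭ys))

  sort-resp-↭ : ∀ {xs ys} → xs ↭ ys → sort xs ≡ sort ys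
  sort-resp-↭ {xs} {ys} xs↭ys =
    sorted-↭-unique (sort-↗ xs) (sort-↗ ys) (↭-trans (sort-↭ xs) (↭-trans xs↭ys (↭-sym (sort-↭ ys))))

  sort-≡⇒↭ : ∀ {xs ys} → sort xs ≡ sort ys → xs ↭ ys
  sort-≡⇒↭ {xs} {ys} eq = ↭-trans (↭-sym (sort-↭ xs)) (↭-trans (↭-reflexive eq) (sort-↭ ys))

  sort-sorted : ∀ {xs} → Sorted xs → sort xs ≡ xs
  sort-sorted {xs} xs↗ = sorted-↭-unique (sort-↗ xs) xs↗ (sort-↭ xs)

  Sorted-map : ∀ (f : A → A) → f Preserves _≤_ ⟶ _≤_ → ∀ {xs} → Sorted xs → Sorted (map f xs)
  Sorted-map f mono = map⁺ totalOrder totalOrder mono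

  sort-map : ∀ {f : A → A} → f Preserves _≤_ ⟶ _≤_ → ∀ xs → sort (map f xs) ≡ map f (sort xs)
  sort-map {f} mono xs = sorted-↭-unique (sort-↗ (map f xs)) (Sorted-map f mono (sort-↗ xs))
    (↭-trans (sort-↭ (map f xs)) (Perm.map⁺ f (↭-sym (sort-↭ xs))))

  module ByInsertion (ins : A → List A → List A) (ins≡insert : ∀ x ys → ins x ys ≡ insert x ys) where
    foldr-ins≡sort : ∀ xs → foldr ins [] xs ≡ sort xs
    foldr-ins≡sort [] = refl
    foldr-ins≡sort (x ∷ xs) = trans (cong (ins x) (foldr-ins≡sort xs)) (ins≡insert x (sort xs))

    resp-↭ : ∀ {xs ys} → xs ↭ ys → foldr ins [] xs ≡ foldr ins [] ys
    resp-↭ {xs} {ys} p = trans (foldr-ins≡sort xs) (trans (sort-resp-↭ p) (sym (foldr-ins≡sort ys)))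

    ≡⇒↭ : ∀ {xs ys} → foldr ins [] xs ≡ foldr ins [] ys → xs ↭ ys
    ≡⇒↭ {xs} {ys} eq = sort-≡⇒↭ (trans (sym (foldr-ins≡sort xs)) (trans eq (foldr-ins≡sort ys)))

    ↭-self : ∀ xs → foldr ins [] xs ↭ xs
    ↭-self xs = subst (_↭ xs) (sym (foldr-ins≡sort xs)) (sort-↭ xs)

    sorted : ∀ xs → Sorted (foldr ins [] xs)
    sorted xs = subst Sorted (sym (foldr-ins≡sort xs)) (sort-↗ xs)

    sorted⇒id : ∀ {xs} → Sorted xs → foldr ins [] xs ≡ xs
    sorted⇒id {xs} xs↗ = trans (foldr-ins≡sort xs) (sort-sorted xs↗)

    map-comm : ∀ {f : A → A} → f Preserves _≤_ ⟶ _≤_ → ∀ xs → foldr ins [] (map f xs) ≡ map f (foldr ins [] xs)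
    map-comm mono xs = trans (foldr-ins≡sort (map _ xs))
      (trans (sort-map mono xs) (cong (map _) (sym (foldr-ins≡sort xs))))

module ℕ↓ = SortedPermutation (Flip.isDecTotalOrder ℕP.≤-isDecTotalOrder)

insertℕ≡insert : ∀ x ys → insertℕ x ys ≡ ℕ↓.insert x ys
insertℕ≡insert x [] = refl
insertℕ≡insert x (y ∷ ys) with y ≤ᵇ x
... | true = refl
... | false = cong (y ∷_) (insertℕ≡insert x ys)

open ℕ↓.ByInsertion insertℕ insertℕ≡insert
  using () renaming (resp-↭ to sortDescℕ-resp-↭; ≡⇒↭ to sortDescℕ-≡⇒↭; ↭-self to sortDescℕ-↭)

sortDescℕ-idem : ∀ xs → sortDescℕ (sortDescℕ xs) ≡ sortDescℕ xs
sortDescℕ-idem xs = sortDescℕ-resp-↭ (sortDescℕ-↭ xs)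

Lex≥ : Stack → Stack → Set
Lex≥ (d , m) (d' , m') = d' < d ⊎ (d ≡ d' × m' ≤ m)

≥ˢ⇒Lex≥ : ∀ x y → T (x ≥ˢ y) → Lex≥ x y
≥ˢ⇒Lex≥ (d , m) (d' , m') h with d' <ᵇ d in eq
... | true = inj₁ (ℕP.<ᵇ⇒< d' d (≡true⇒T eq))
... | false = let (d≡d' , m'≤m) = T-∧⁻ h in inj₂ (ℕP.≡ᵇ⇒≡ d d' d≡d' , ℕP.≤ᵇ⇒≤ m' m m'≤m)

Lex≥⇒≥ˢ : ∀ x y → Lex≥ x y → T (x ≥ˢ y)
Lex≥⇒≥ˢ (d , m) (d' , m') (inj₁ d'<d) = Equivalence.from T-∨ (inj₁ (ℕP.<⇒<ᵇ d'<d))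
Lex≥⇒≥ˢ (d , m) (d , m') (inj₂ (refl , m'≤m)) =
  Equivalence.from T-∨ (inj₂ (T-∧⁺ (ℕP.≡⇒≡ᵇ d d refl) (ℕP.≤⇒≤ᵇ m'≤m)))

_≥ˢᵀ_ : Rel Stack 0ℓ
x ≥ˢᵀ y = T (x ≥ˢ y)

≥ˢ-isDecTotalOrder : IsDecTotalOrder _≡_ _≥ˢᵀ_
≥ˢ-isDecTotalOrder = record
  { isTotalOrder = record
    { isPartialOrder = record
      { isPreorder = record
        { isEquivalence = isEquivalence
        ; reflexive = λ { {x} refl → Lex≥⇒≥ˢ x x (inj₂ (refl , ℕP.≤-refl)) }
        ; trans = λ {x} {y} {z} p q → Lex≥⇒≥ˢ x z (Lex≥-trans x y z (≥ˢ⇒Lex≥ x y p) (≥ˢ⇒Lex≥ y z q))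
        }
      ; antisym = λ {x} {y} p q → Lex≥-antisym x y (≥ˢ⇒Lex≥ x y p) (≥ˢ⇒Lex≥ y x q)
      }
    ; total = λ x y → Sum.map (Lex≥⇒≥ˢ x y) (Lex≥⇒≥ˢ y x) (Lex≥-total x y)
    }
  ; _≟_ = ×P.≡-dec ℕP._≟_ ℕP._≟_
  ; _≤?_ = λ x y → T? (x ≥ˢ y)
  }
  where
  Lex≥-trans : ∀ x y z → Lex≥ x y → Lex≥ y z → Lex≥ x z
  Lex≥-trans _ _ _ (inj₁ a) (inj₁ b) = inj₁ (ℕP.<-trans b a)
  Lex≥-trans _ _ _ (inj₁ a) (inj₂ (refl , _)) = inj₁ a
  Lex≥-trans _ _ _ (inj₂ (refl , _)) (inj₁ b) = inj₁ b
  Lex≥-trans _ _ _ (inj₂ (refl , a)) (inj₂ (refl , b)) = inj₂ (refl , ℕP.≤-trans b a)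
  Lex≥-antisym : ∀ x y → Lex≥ x y → Lex≥ y x → x ≡ y
  Lex≥-antisym _ _ (inj₁ a) (inj₁ b) = ⊥-elim (ℕP.<-asym a b)
  Lex≥-antisym _ _ (inj₁ a) (inj₂ (refl , _)) = ⊥-elim (ℕP.<-irrefl refl a)
  Lex≥-antisym _ _ (inj₂ (refl , _)) (inj₁ b) = ⊥-elim (ℕP.<-irrefl refl b)
  Lex≥-antisym _ _ (inj₂ (refl , a)) (inj₂ (_ , b)) = cong (_ ,_) (ℕP.≤-antisym b a)
  Lex≥-total : ∀ x y → Lex≥ x y ⊎ Lex≥ y x
  Lex≥-total (d , m) (d' , m') with ℕP.<-cmp d d'
  ... | tri< d<d' _ _ = inj₂ (inj₁ d<d')
  ... | tri> _ _ d'<d = inj₁ (inj₁ d'<d)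
  ... | tri≈ _ refl _ with ℕP.≤-total m m'
  ...   | inj₁ m≤m' = inj₂ (inj₂ (refl , m≤m'))
  ...   | inj₂ m'≤m = inj₁ (inj₂ (refl , m'≤m))

module SP↓ = SortedPermutation ≥ˢ-isDecTotalOrder

insertˢ≡insert : ∀ x ys → insertˢ x ys ≡ SP↓.insert x ys
insertˢ≡insert x [] = refl
insertˢ≡insert x (y ∷ ys) with x ≥ˢ y
... | true = refl
... | false = cong (y ∷_) (insertˢ≡insert x ys)

open SP↓.ByInsertion insertˢ insertˢ≡insert
  using () renaming (resp-↭ to sortSP-resp-↭; ≡⇒↭ to sortSP-≡⇒↭; ↭-self to sortSP-↭;
                     sorted⇒id to Sorted⇒sortSP-id; sorted to sortSP-Sorted; map-comm to sortSP-map)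

sortedDesc⇒Sorted : ∀ {xs} → T (sortedDesc xs) → SP↓.Sorted xs
sortedDesc⇒Sorted {[]} _ = Linked.[]
sortedDesc⇒Sorted {x ∷ []} _ = Linked.[-]
sortedDesc⇒Sorted {x ∷ y ∷ xs} h = let (x≥y , rest) = T-∧⁻ h in x≥y Linked.∷ sortedDesc⇒Sorted rest

Sorted⇒sortedDesc : ∀ {xs} → SP↓.Sorted xs → T (sortedDesc xs)
Sorted⇒sortedDesc Linked.[] = tt
Sorted⇒sortedDesc Linked.[-] = tt
Sorted⇒sortedDesc (x≥y Linked.∷ rest) = T-∧⁺ x≥y (Sorted⇒sortedDesc rest)

sortedDesc⇒sortSP-id : ∀ {xs} → T (sortedDesc xs) → sortSP xs ≡ xs
sortedDesc⇒sortSP-id h = Sorted⇒sortSP-id (sortedDesc⇒Sorted h)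

sortedDesc-sortSP : ∀ xs → T (sortedDesc (sortSP xs))
sortedDesc-sortSP xs = Sorted⇒sortedDesc (sortSP-Sorted xs)

Positive : SP → Set
Positive = All (λ s → 1 ≤ proj₁ s × 1 ≤ proj₂ s)

positiveStacks⇒Positive : ∀ β → T (positiveStacks β) → Positive β
positiveStacks⇒Positive [] _ = []
positiveStacks⇒Positive ((d , m) ∷ β) h =
  let (1≤d , rest) = T-∧⁻ h ; (1≤m , hβ) = T-∧⁻ rest in
  (ℕP.≤ᵇ⇒≤ 1 d 1≤d , ℕP.≤ᵇ⇒≤ 1 m 1≤m) ∷ positiveStacks⇒Positive β hβ

Positive⇒positiveStacks : ∀ {β} → Positive β → T (positiveStacks β)
Positive⇒positiveStacks [] = tt
Positive⇒positiveStacks ((1≤d , 1≤m) ∷ pβ) =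
  T-∧⁺ (ℕP.≤⇒≤ᵇ 1≤d) (T-∧⁺ (ℕP.≤⇒≤ᵇ 1≤m) (Positive⇒positiveStacks pβ))

stackPartition-Positive : ∀ n τ → T (isStackPartition n τ) → Positive τ
stackPartition-Positive n τ τ⊩n = positiveStacks⇒Positive τ (proj₁ (T-∧⁻ {positiveStacks τ} τ⊩n))

stackPartition-sortedDesc : ∀ n τ → T (isStackPartition n τ) → T (sortedDesc τ)
stackPartition-sortedDesc n τ τ⊩n = proj₁ (T-∧⁻ (proj₂ (T-∧⁻ {positiveStacks τ} τ⊩n)))

stackPartition-weight : ∀ n τ → T (isStackPartition n τ) → weight τ ≡ n
stackPartition-weight n τ τ⊩n =
  ℕP.≡ᵇ⇒≡ (weight τ) n (proj₂ (T-∧⁻ {sortedDesc τ} (proj₂ (T-∧⁻ {positiveStacks τ} τ⊩n))))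

-- Convolution of functions of a row

nonzeros : List ℕ → List ℕ
nonzeros = filterᵇ (λ k → 1 ≤ᵇ k)

nonzeros-idem : ∀ r → nonzeros (nonzeros r) ≡ nonzeros r
nonzeros-idem [] = refl
nonzeros-idem (zero ∷ r) = nonzeros-idem r
nonzeros-idem (suc k ∷ r) = cong (suc k ∷_) (nonzeros-idem r)

RowFn : Set
RowFn = List ℕ → ℕ

PermInvariant : RowFn → Set
PermInvariant f = ∀ {r r'} → r ↭ r' → f r ≡ f r'

ZeroInvariant : RowFn → Set
ZeroInvariant f = ∀ r → f r ≡ f (nonzeros r)

consSplit : ℕ → ℕ → List ℕ × List ℕ → List ℕ × List ℕ
consSplit k i ab = (i ∷ proj₁ ab , (k ∸ i) ∷ proj₂ ab)

splits : List ℕ → List (List ℕ × List ℕ)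
splits [] = ([] , []) ∷ []
splits (k ∷ t) = concatMap (λ i → map (consSplit k i) (splits t)) (upTo (suc k))

∑-splits-∷ : ∀ k t (F : List ℕ × List ℕ → ℕ) →
  ∑ (splits (k ∷ t)) F ≡ ∑ (upTo (suc k)) (λ i → ∑ (splits t) (λ ab → F (i ∷ proj₁ ab , (k ∸ i) ∷ proj₂ ab)))
∑-splits-∷ k t F = trans (ℕΣ.∑-concatMap (λ i → map (consSplit k i) (splits t)) (upTo (suc k)) F)
                          (ℕΣ.∑-cong (upTo (suc k)) (λ i → ℕΣ.∑-map (consSplit k i) (splits t) F))

infixr 7 _⋆_

_⋆_ : RowFn → RowFn → RowFn
(f ⋆ g) t = ∑ (splits t) (λ ab → f (proj₁ ab) * g (proj₂ ab))

δ₀ : RowFn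
δ₀ [] = 1
δ₀ (zero ∷ t) = δ₀ t
δ₀ (suc _ ∷ t) = 0

⋆-product : List RowFn → RowFn
⋆-product = foldr _⋆_ δ₀

⋆-∷ : ∀ f g k t → (f ⋆ g) (k ∷ t) ≡ ∑ (upTo (suc k)) (λ i → ((f ∘ (i ∷_)) ⋆ (g ∘ ((k ∸ i) ∷_))) t)
⋆-∷ f g k t = ∑-splits-∷ k t _

⋆-cong : ∀ {f f' g g'} → (∀ r → f r ≡ f' r) → (∀ r → g r ≡ g' r) → ∀ t → (f ⋆ g) t ≡ (f' ⋆ g') t
⋆-cong f≗f' g≗g' t = ℕΣ.∑-cong (splits t) (λ ab → cong₂ _*_ (f≗f' (proj₁ ab)) (g≗g' (proj₂ ab)))

⋆-[] : ∀ f g → (f ⋆ g) [] ≡ f [] * g []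
⋆-[] f g = ℕP.+-identityʳ _

⋆-product-[] : ∀ fs → ⋆-product fs [] ≡ product (map (λ f → f []) fs)
⋆-product-[] [] = refl
⋆-product-[] (f ∷ fs) = trans (⋆-[] f (⋆-product fs)) (cong (f [] *_) (⋆-product-[] fs))

⋆-∷∷ : ∀ f g x y t → (f ⋆ g) (x ∷ y ∷ t) ≡
  ∑ (upTo (suc x)) (λ i → ∑ (upTo (suc y)) (λ j →
    ((λ r → f (i ∷ j ∷ r)) ⋆ (λ r → g ((x ∸ i) ∷ (y ∸ j) ∷ r))) t))
⋆-∷∷ f g x y t =
  trans (⋆-∷ f g x (y ∷ t)) (ℕΣ.∑-cong (upTo (suc x)) (λ i → ⋆-∷ (f ∘ (i ∷_)) (g ∘ ((x ∸ i) ∷_)) y t))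

⋆-resp-↭ : ∀ {f g} → PermInvariant f → PermInvariant g → PermInvariant (f ⋆ g)
⋆-resp-↭ f↭ g↭ ↭.refl = refl
⋆-resp-↭ f↭ g↭ (↭.trans p q) = trans (⋆-resp-↭ f↭ g↭ p) (⋆-resp-↭ f↭ g↭ q)
⋆-resp-↭ {f} {g} f↭ g↭ (↭.prep {xs} {ys} k p) = begin
  (f ⋆ g) (k ∷ xs)
    ≡⟨ ⋆-∷ f g k xs ⟩
  ∑ (upTo (suc k)) (λ i → ((f ∘ (i ∷_)) ⋆ (g ∘ ((k ∸ i) ∷_))) xs)
    ≡⟨ ℕΣ.∑-cong (upTo (suc k)) (λ i → ⋆-resp-↭ (f↭ ∘ ↭-prep i) (g↭ ∘ ↭-prep (k ∸ i)) p) ⟩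
  ∑ (upTo (suc k)) (λ i → ((f ∘ (i ∷_)) ⋆ (g ∘ ((k ∸ i) ∷_))) ys)
    ≡⟨ ⋆-∷ f g k ys ⟨
  (f ⋆ g) (k ∷ ys) ∎
  where open ≡-Reasoning
⋆-resp-↭ {f} {g} f↭ g↭ (↭.swap {xs} {ys} x y p) = begin
  (f ⋆ g) (x ∷ y ∷ xs)
    ≡⟨ ⋆-∷∷ f g x y xs ⟩
  ∑ (upTo (suc x)) (λ i → ∑ (upTo (suc y)) (λ j → (fᵢⱼ i j ⋆ gᵢⱼ x y i j) xs))
    ≡⟨ ℕΣ.∑-cong (upTo (suc x)) (λ i → ℕΣ.∑-cong (upTo (suc y)) (λ j → swapped i j)) ⟩
  ∑ (upTo (suc x)) (λ i → ∑ (upTo (suc y)) (λ j → (fᵢⱼ j i ⋆ gᵢⱼ y x j i) ys))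
    ≡⟨ ℕΣ.∑-comm (upTo (suc x)) (upTo (suc y)) _ ⟩
  ∑ (upTo (suc y)) (λ j → ∑ (upTo (suc x)) (λ i → (fᵢⱼ j i ⋆ gᵢⱼ y x j i) ys))
    ≡⟨ ⋆-∷∷ f g y x ys ⟨
  (f ⋆ g) (y ∷ x ∷ ys) ∎
  where
  open ≡-Reasoning
  fᵢⱼ : ℕ → ℕ → RowFn
  fᵢⱼ i j r = f (i ∷ j ∷ r)
  gᵢⱼ : ℕ → ℕ → ℕ → ℕ → RowFn
  gᵢⱼ x y i j r = g ((x ∸ i) ∷ (y ∸ j) ∷ r)
  swapped : ∀ i j → (fᵢⱼ i j ⋆ gᵢⱼ x y i j) xs ≡ (fᵢⱼ j i ⋆ gᵢⱼ y x j i) ys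
  swapped i j = trans (⋆-resp-↭ (f↭ ∘ ↭-prep i ∘ ↭-prep j) (g↭ ∘ ↭-prep (x ∸ i) ∘ ↭-prep (y ∸ j)) p)
                      (⋆-cong (λ _ → f↭ (↭-swap i j ↭-refl)) (λ _ → g↭ (↭-swap (x ∸ i) (y ∸ j) ↭-refl)) ys)

nonzeros-∷-nonzeros : ∀ i r → nonzeros (i ∷ nonzeros r) ≡ nonzeros (i ∷ r)
nonzeros-∷-nonzeros zero r = nonzeros-idem r
nonzeros-∷-nonzeros (suc i) r = cong (suc i ∷_) (nonzeros-idem r)

ZeroInvariant-∷ : ∀ {f} i → ZeroInvariant f → ZeroInvariant (f ∘ (i ∷_))
ZeroInvariant-∷ {f} i f0 r =
  trans (f0 (i ∷ r)) (trans (cong f (sym (nonzeros-∷-nonzeros i r))) (sym (f0 (i ∷ nonzeros r))))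

⋆-nonzeros : ∀ {f g} → ZeroInvariant f → ZeroInvariant g → ZeroInvariant (f ⋆ g)
⋆-nonzeros f0 g0 [] = refl
⋆-nonzeros {f} {g} f0 g0 (zero ∷ t) = begin
  (f ⋆ g) (0 ∷ t)                           ≡⟨ ⋆-∷ f g 0 t ⟩
  ((f ∘ (0 ∷_)) ⋆ (g ∘ (0 ∷_))) t + 0       ≡⟨ ℕP.+-identityʳ _ ⟩
  ((f ∘ (0 ∷_)) ⋆ (g ∘ (0 ∷_))) t           ≡⟨ ⋆-cong (drop0 f0) (drop0 g0) t ⟩
  (f ⋆ g) t                                 ≡⟨ ⋆-nonzeros f0 g0 t ⟩
  (f ⋆ g) (nonzeros t)                      ∎
  where
  open ≡-Reasoning
  drop0 : ∀ {h} → ZeroInvariant h → ∀ r → h (0 ∷ r) ≡ h r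
  drop0 h0 r = trans (h0 (0 ∷ r)) (sym (h0 r))
⋆-nonzeros {f} {g} f0 g0 (suc k ∷ t) =
  trans (⋆-∷ f g (suc k) t)
  (trans (ℕΣ.∑-cong (upTo (suc (suc k))) (λ i → ⋆-nonzeros (ZeroInvariant-∷ i f0) (ZeroInvariant-∷ (suc k ∸ i) g0) t))
         (sym (⋆-∷ f g (suc k) (nonzeros t))))

δ₀-PermInvariant : PermInvariant δ₀
δ₀-PermInvariant ↭.refl = refl
δ₀-PermInvariant (↭.trans p q) = trans (δ₀-PermInvariant p) (δ₀-PermInvariant q)
δ₀-PermInvariant (↭.prep zero p) = δ₀-PermInvariant p
δ₀-PermInvariant (↭.prep (suc _) p) = refl
δ₀-PermInvariant (↭.swap zero zero p) = δ₀-PermInvariant p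
δ₀-PermInvariant (↭.swap zero (suc _) p) = refl
δ₀-PermInvariant (↭.swap (suc _) zero p) = refl
δ₀-PermInvariant (↭.swap (suc _) (suc _) p) = refl

δ₀-ZeroInvariant : ZeroInvariant δ₀
δ₀-ZeroInvariant [] = refl
δ₀-ZeroInvariant (zero ∷ t) = δ₀-ZeroInvariant t
δ₀-ZeroInvariant (suc _ ∷ t) = refl

⋆-product-PermInvariant : ∀ {fs} → All PermInvariant fs → PermInvariant (⋆-product fs)
⋆-product-PermInvariant [] = δ₀-PermInvariant
⋆-product-PermInvariant (f↭ ∷ fs↭) = ⋆-resp-↭ f↭ (⋆-product-PermInvariant fs↭)

⋆-product-ZeroInvariant : ∀ {fs} → All ZeroInvariant fs → ZeroInvariant (⋆-product fs)
⋆-product-ZeroInvariant [] = δ₀-ZeroInvariant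
⋆-product-ZeroInvariant (f0 ∷ fs0) = ⋆-nonzeros f0 (⋆-product-ZeroInvariant fs0)

isArrangement : List ℕ → List ℕ → Bool
isArrangement b r = sortDescℕ (nonzeros r) ==ℕs sortDescℕ b

arrangement : List ℕ → RowFn
arrangement b r = ind (isArrangement b r)

isArrangement⇒↭ : ∀ b r → T (isArrangement b r) → nonzeros r ↭ b
isArrangement⇒↭ b r h = sortDescℕ-≡⇒↭ (==ℕs⇒≡ h)

↭⇒isArrangement : ∀ b r → nonzeros r ↭ b → T (isArrangement b r)
↭⇒isArrangement b r p = ≡⇒==ℕs (sortDescℕ-resp-↭ p)

isArrangement-resp-↭ : ∀ {b b'} → b ↭ b' → ∀ r → isArrangement b r ≡ isArrangement b' r
isArrangement-resp-↭ p r = cong (sortDescℕ (nonzeros r) ==ℕs_) (sortDescℕ-resp-↭ p)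

arrangement-PermInvariant : ∀ b → PermInvariant (arrangement b)
arrangement-PermInvariant b p =
  cong (λ l → ind (l ==ℕs sortDescℕ b)) (sortDescℕ-resp-↭ (Perm.filter-↭ (T? ∘ (1 ≤ᵇ_)) p))

arrangement-ZeroInvariant : ∀ b → ZeroInvariant (arrangement b)
arrangement-ZeroInvariant b r = cong (λ l → ind (sortDescℕ l ==ℕs sortDescℕ b)) (sym (nonzeros-idem r))

All-nonzeros⁻ : ∀ {P : ℕ → Set} → P 0 → ∀ a → All P (nonzeros a) → All P a
All-nonzeros⁻ P0 [] _ = []
All-nonzeros⁻ P0 (zero ∷ a) pa = P0 ∷ All-nonzeros⁻ P0 a pa
All-nonzeros⁻ P0 (suc k ∷ a) (pk ∷ pa) = pk ∷ All-nonzeros⁻ P0 a pa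

arrangement-bounded : ∀ b a → ¬ All (_< suc (sum b)) a → arrangement b a ≡ 0
arrangement-bounded b a a≮ with isArrangement b a in eq
... | false = refl
... | true = ⊥-elim (a≮ (All-nonzeros⁻ (s≤s z≤n) a
               (Perm.All-resp-↭ (↭-sym (isArrangement⇒↭ b a (≡true⇒T eq)))
                                (All.map s≤s (All-≤-sum b)))))

zeroCount : List ℕ → ℕ
zeroCount [] = 0
zeroCount (zero ∷ x) = suc (zeroCount x)
zeroCount (suc _ ∷ x) = zeroCount x

↭-nonzeros-zeros : ∀ x → x ↭ nonzeros x ++ replicate (zeroCount x) 0
↭-nonzeros-zeros [] = ↭-refl
↭-nonzeros-zeros (zero ∷ x) =
  ↭-trans (↭-prep 0 (↭-nonzeros-zeros x)) (↭-sym (Perm.shift 0 (nonzeros x) (replicate (zeroCount x) 0)))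
↭-nonzeros-zeros (suc k ∷ x) = ↭-prep (suc k) (↭-nonzeros-zeros x)

length-nonzeros-zeros : ∀ x → length x ≡ length (nonzeros x) + zeroCount x
length-nonzeros-zeros [] = refl
length-nonzeros-zeros (zero ∷ x) = trans (cong suc (length-nonzeros-zeros x)) (sym (ℕP.+-suc _ _))
length-nonzeros-zeros (suc k ∷ x) = cong suc (length-nonzeros-zeros x)

nonzeros-replicate-0 : ∀ n → nonzeros (replicate n 0) ≡ []
nonzeros-replicate-0 zero = refl
nonzeros-replicate-0 (suc n) = nonzeros-replicate-0 n

padded-arrangement : ∀ L b x → length x ≡ L → nonzeros b ≡ b →
  (sortDescℕ x ==ℕs sortDescℕ (b ++ replicate (L ∸ length b) 0)) ≡ isArrangement b x
padded-arrangement L b x |x|≡L b-nz = T-ext to from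
  where
  zeros : List ℕ
  zeros = replicate (L ∸ length b) 0
  to : T (sortDescℕ x ==ℕs sortDescℕ (b ++ zeros)) → T (isArrangement b x)
  to h = ↭⇒isArrangement b x (subst (nonzeros x ↭_) nonzeros-padded
           (Perm.filter-↭ (T? ∘ (1 ≤ᵇ_)) (sortDescℕ-≡⇒↭ {x} {b ++ zeros} (==ℕs⇒≡ h))))
    where
    nonzeros-padded : nonzeros (b ++ zeros) ≡ b
    nonzeros-padded = trans (LP.filter-++ (T? ∘ (1 ≤ᵇ_)) b zeros)
      (trans (cong₂ _++_ b-nz (nonzeros-replicate-0 (L ∸ length b))) (LP.++-identityʳ b))
  from : T (isArrangement b x) → T (sortDescℕ x ==ℕs sortDescℕ (b ++ zeros))
  from h = ≡⇒==ℕs (sortDescℕ-resp-↭ (↭-trans (↭-nonzeros-zeros x)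
             (subst (λ n → nonzeros x ++ replicate (zeroCount x) 0 ↭ b ++ replicate n 0) zeroCount≡
                    (Perm.++⁺ʳ _ nz↭b))))
    where
    nz↭b : nonzeros x ↭ b
    nz↭b = isArrangement⇒↭ b x h
    zeroCount≡ : zeroCount x ≡ L ∸ length b
    zeroCount≡ = trans (sym (ℕP.m+n∸m≡n (length (nonzeros x)) (zeroCount x)))
                       (cong₂ _∸_ (trans (sym (length-nonzeros-zeros x)) |x|≡L) (Perm.↭-length nz↭b))

-- Matrices with prescribed rows and column sums

_≤*ᵇ_ : List ℕ → List ℕ → Bool
[] ≤*ᵇ [] = true
(x ∷ xs) ≤*ᵇ (t ∷ ts) = (x ≤ᵇ t) ∧ (xs ≤*ᵇ ts)
_ ≤*ᵇ _ = false

≤ᵇ-false : ∀ {i k} → k < i → (i ≤ᵇ k) ≡ false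
≤ᵇ-false {i} {k} k<i = ¬T⇒≡false (λ i≤k → ℕP.<⇒≱ k<i (ℕP.≤ᵇ⇒≤ i k i≤k))

-- Turns a sum over all rows with entries below K, as enumerated by rowCandidates, into a sum over the
-- splittings of t.
∑-lists-≤* : ∀ t K (F : List ℕ → List ℕ → ℕ) → (∀ a c → ¬ All (_< K) a → F a c ≡ 0) →
  ∑ (listsOfLength (length t) (upTo K)) (λ x → ind (x ≤*ᵇ t) * F x (zipWith _∸_ t x))
    ≡ ∑ (splits t) (λ ac → F (proj₁ ac) (proj₂ ac))
∑-lists-≤* [] K F _ = cong (_+ 0) (ℕP.*-identityˡ (F [] []))
∑-lists-≤* (k ∷ t) K F F0 = begin
  ∑ (listsOfLength (suc (length t)) (upTo K)) (λ x → ind (x ≤*ᵇ (k ∷ t)) * F x (zipWith _∸_ (k ∷ t) x))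
    ≡⟨ ℕΣ.∑-listsOfLength-suc (length t) (upTo K) _ ⟩
  ∑ (upTo K) (λ i → ∑ lists (λ x → ind ((i ≤ᵇ k) ∧ (x ≤*ᵇ t)) * Fᵢ i x (zipWith _∸_ t x)))
    ≡⟨ ℕΣ.∑-cong (upTo K) (λ i → trans (ℕΣ.∑-cong lists (λ x → factor (i ≤ᵇ k) (x ≤*ᵇ t) _))
                                       (sym (ℕΣ.∑-*ˡ (ind (i ≤ᵇ k)) lists _))) ⟩
  ∑ (upTo K) (λ i → ind (i ≤ᵇ k) * ∑ lists (λ x → ind (x ≤*ᵇ t) * Fᵢ i x (zipWith _∸_ t x)))
    ≡⟨ ℕΣ.∑-cong (upTo K) (λ i → cong (ind (i ≤ᵇ k) *_)
         (∑-lists-≤* t K (Fᵢ i) (λ a c a≮K → F0 (i ∷ a) _ (λ { (_ ∷ pa) → a≮K pa })))) ⟩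
  ∑ (upTo K) h
    ≡⟨ ∑-upTo-truncate h (ℕP.≤⇒≤′ (ℕP.m≤m+n K (suc k))) (λ i K≤i →
         trans (cong (ind (i ≤ᵇ k) *_) (G0 i K≤i)) (ℕP.*-zeroʳ (ind (i ≤ᵇ k)))) ⟨
  ∑ (upTo (K + suc k)) h
    ≡⟨ ∑-upTo-truncate h (ℕP.≤⇒≤′ (ℕP.m≤n+m (suc k) K)) (λ i k<i → cong (λ b → ind b * G i) (≤ᵇ-false k<i)) ⟩
  ∑ (upTo (suc k)) h
    ≡⟨ ℕΣ.∑-cong-All (AllP.all-upTo (suc k)) (λ {i} i<sk →
         trans (cong (λ b → ind b * G i) (T⇒≡true (ℕP.≤⇒≤ᵇ (ℕP.≤-pred i<sk)))) (ℕP.+-identityʳ (G i))) ⟩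
  ∑ (upTo (suc k)) G
    ≡⟨ ∑-splits-∷ k t _ ⟨
  ∑ (splits (k ∷ t)) (λ ac → F (proj₁ ac) (proj₂ ac)) ∎
  where
  open ≡-Reasoning
  lists : List (List ℕ)
  lists = listsOfLength (length t) (upTo K)
  Fᵢ : ℕ → List ℕ → List ℕ → ℕ
  Fᵢ i a c = F (i ∷ a) ((k ∸ i) ∷ c)
  G : ℕ → ℕ
  G i = ∑ (splits t) (λ ac → Fᵢ i (proj₁ ac) (proj₂ ac))
  h : ℕ → ℕ
  h i = ind (i ≤ᵇ k) * G i
  G0 : ∀ i → K ≤ i → G i ≡ 0
  G0 i K≤i = ℕΣ.∑-zero (splits t) (λ ac → F0 (i ∷ proj₁ ac) _ (λ { (i<K ∷ _) → ℕP.<⇒≱ i<K K≤i }))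
  factor : ∀ a b n → ind (a ∧ b) * n ≡ ind a * (ind b * n)
  factor a b n = trans (cong (_* n) (ind-∧ a b)) (ℕP.*-assoc (ind a) (ind b) n)

==ℕs-∷ : ∀ a as b bs → ((a ∷ as) ==ℕs (b ∷ bs)) ≡ (a ≡ᵇ b) ∧ (as ==ℕs bs)
==ℕs-∷ a as b bs = T-ext
  (λ h → let eq = ==ℕs⇒≡ {a ∷ as} {b ∷ bs} h in
         T-∧⁺ (ℕP.≡⇒≡ᵇ a b (LP.∷-injectiveˡ eq)) (≡⇒==ℕs (LP.∷-injectiveʳ eq)))
  (λ h → let (a≡b , as≡bs) = T-∧⁻ h in ≡⇒==ℕs (cong₂ _∷_ (ℕP.≡ᵇ⇒≡ a b a≡b) (==ℕs⇒≡ as≡bs)))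

+-≡ᵇ : ∀ a c d → (a + c ≡ᵇ d) ≡ (a ≤ᵇ d) ∧ (c ≡ᵇ d ∸ a)
+-≡ᵇ a c d = T-ext
  (λ h → let eq = ℕP.≡ᵇ⇒≡ (a + c) d h in
         T-∧⁺ (ℕP.≤⇒≤ᵇ (subst (a ≤_) eq (ℕP.m≤m+n a c)))
              (ℕP.≡⇒≡ᵇ c (d ∸ a) (trans (sym (ℕP.m+n∸m≡n a c)) (cong (_∸ a) eq))))
  (λ h → let (a≤d , c≡d∸a) = T-∧⁻ h in
         ℕP.≡⇒≡ᵇ (a + c) d (trans (cong (_+_ a) (ℕP.≡ᵇ⇒≡ c (d ∸ a) c≡d∸a)) (ℕP.m+[n∸m]≡n (ℕP.≤ᵇ⇒≤ a d a≤d))))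

∧-interchange : ∀ p q r s → (p ∧ q) ∧ (r ∧ s) ≡ (p ∧ r) ∧ (q ∧ s)
∧-interchange = CommSemigroupProps.interchange (CommutativeMonoid.commutativeSemigroup ∧-commutativeMonoid)

zipWith-+-==ℕs : ∀ x s t → length x ≡ length t → length s ≡ length t →
  (zipWith _+_ x s ==ℕs t) ≡ (x ≤*ᵇ t) ∧ (s ==ℕs zipWith _∸_ t x)
zipWith-+-==ℕs [] [] [] _ _ = refl
zipWith-+-==ℕs (a ∷ x) (c ∷ s) (d ∷ t) |x| |s| = begin
  (zipWith _+_ (a ∷ x) (c ∷ s) ==ℕs (d ∷ t))
    ≡⟨ ==ℕs-∷ (a + c) (zipWith _+_ x s) d t ⟩
  (a + c ≡ᵇ d) ∧ (zipWith _+_ x s ==ℕs t)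
    ≡⟨ cong₂ _∧_ (+-≡ᵇ a c d) (zipWith-+-==ℕs x s t (ℕP.suc-injective |x|) (ℕP.suc-injective |s|)) ⟩
  ((a ≤ᵇ d) ∧ (c ≡ᵇ d ∸ a)) ∧ ((x ≤*ᵇ t) ∧ (s ==ℕs zipWith _∸_ t x))
    ≡⟨ ∧-interchange (a ≤ᵇ d) (c ≡ᵇ d ∸ a) (x ≤*ᵇ t) _ ⟩
  ((a ∷ x) ≤*ᵇ (d ∷ t)) ∧ ((c ≡ᵇ d ∸ a) ∧ (s ==ℕs zipWith _∸_ t x))
    ≡⟨ cong (((a ∷ x) ≤*ᵇ (d ∷ t)) ∧_) (==ℕs-∷ c s (d ∸ a) (zipWith _∸_ t x)) ⟨
  ((a ∷ x) ≤*ᵇ (d ∷ t)) ∧ ((c ∷ s) ==ℕs zipWith _∸_ (d ∷ t) (a ∷ x)) ∎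
  where open ≡-Reasoning
zipWith-+-==ℕs [] (_ ∷ _) [] _ ()
zipWith-+-==ℕs (_ ∷ _) _ [] ()
zipWith-+-==ℕs [] _ (_ ∷ _) ()
zipWith-+-==ℕs (_ ∷ _) [] (_ ∷ _) _ ()

length-zipWith-≡ : ∀ (f : ℕ → ℕ → ℕ) {L} xs ys → length xs ≡ L → length ys ≡ L → length (zipWith f xs ys) ≡ L
length-zipWith-≡ f {L} xs ys refl |ys| =
  trans (LP.length-zipWith f xs ys) (trans (cong (ℕ._⊓_ L) |ys|) (ℕP.⊓-idem L))

length-columnSums : ∀ L {rows} → All (λ r → length r ≡ L) rows → length (columnSums L rows) ≡ L
length-columnSums L [] = LP.length-replicate L
length-columnSums L {r ∷ rows} (|r| ∷ |rows|) =
  length-zipWith-≡ _+_ r (columnSums L rows) |r| (length-columnSums L |rows|)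

rowCandidates-length : ∀ L b → All (λ r → length r ≡ L) (rowCandidates L b)
rowCandidates-length L b = AllP.filter⁺ _ (listsOfLength-length L _)

∑-rowCandidates : ∀ L b (g : List ℕ → ℕ) → nonzeros b ≡ b →
  ∑ (rowCandidates L b) g ≡ ∑ (listsOfLength L (upTo (suc (sum b)))) (λ x → arrangement b x * g x)
∑-rowCandidates L b g b-nz = trans (ℕΣ.∑-filterᵇ _ (listsOfLength L (upTo (suc (sum b)))) g)
  (ℕΣ.∑-cong-All (listsOfLength-length L _) (λ {x} |x| →
    trans (if-then-0 _ (g x)) (cong (λ c → ind c * g x) (padded-arrangement L b x |x| b-nz))))

matrixCount : ℕ → List (List ℕ) → List ℕ → ℕ
matrixCount L bs t = ∑ (cartesian (map (rowCandidates L) bs)) (λ rows → ind (columnSums L rows ==ℕs t))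

replicate-0-==ℕs : ∀ L t → length t ≡ L → ind (replicate L 0 ==ℕs t) ≡ δ₀ t
replicate-0-==ℕs zero [] _ = refl
replicate-0-==ℕs (suc L) (x ∷ t) |t| =
  trans (cong ind (==ℕs-∷ 0 (replicate L 0) x t)) (trans (ind-∧ (0 ≡ᵇ x) _) (head x))
  where
  head : ∀ x → ind (0 ≡ᵇ x) * ind (replicate L 0 ==ℕs t) ≡ δ₀ (x ∷ t)
  head zero = trans (ℕP.+-identityʳ _) (replicate-0-==ℕs L t (ℕP.suc-injective |t|))
  head (suc _) = refl

matrixCount-∷ : ∀ b bs t →
  matrixCount (length t) (b ∷ bs) t ≡
  ∑ (rowCandidates (length t) b) (λ x → ind (x ≤*ᵇ t) * matrixCount (length t) bs (zipWith _∸_ t x))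
matrixCount-∷ b bs t = trans (ℕΣ.∑-cartesian-∷ (rowCandidates L b) (map (rowCandidates L) bs) _)
  (ℕΣ.∑-cong-All (rowCandidates-length L b) (λ {x} |x| →
    trans (ℕΣ.∑-cong-All (cartesian-All (AllP.map⁺ (All.universal (rowCandidates-length L) bs))) (λ {rows} |rows| →
            trans (cong ind (zipWith-+-==ℕs x (columnSums L rows) t |x| (length-columnSums L |rows|)))
                  (ind-∧ (x ≤*ᵇ t) _)))
          (sym (ℕΣ.∑-*ˡ (ind (x ≤*ᵇ t)) rest _))))
  where
  L : ℕ
  L = length t
  rest : List (List (List ℕ))
  rest = cartesian (map (rowCandidates L) bs)

matrixCount≡⋆-product : ∀ L bs t → length t ≡ L → All (λ b → nonzeros b ≡ b) bs →
  matrixCount L bs t ≡ ⋆-product (map arrangement bs) t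
matrixCount≡⋆-product L [] t |t| _ = trans (ℕP.+-identityʳ _) (replicate-0-==ℕs L t |t|)
matrixCount≡⋆-product .(length t) (b ∷ bs) t refl (b-nz ∷ bs-nz) = begin
  matrixCount L (b ∷ bs) t
    ≡⟨ matrixCount-∷ b bs t ⟩
  ∑ (rowCandidates L b) (λ x → ind (x ≤*ᵇ t) * matrixCount L bs (zipWith _∸_ t x))
    ≡⟨ ℕΣ.∑-cong-All (rowCandidates-length L b) (λ {x} |x| → cong (ind (x ≤*ᵇ t) *_)
         (matrixCount≡⋆-product L bs (zipWith _∸_ t x) (length-zipWith-≡ _∸_ t x refl |x|) bs-nz)) ⟩
  ∑ (rowCandidates L b) (λ x → ind (x ≤*ᵇ t) * W (zipWith _∸_ t x))
    ≡⟨ ∑-rowCandidates L b _ b-nz ⟩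
  ∑ (listsOfLength L (upTo (suc (sum b)))) (λ x → arrangement b x * (ind (x ≤*ᵇ t) * W (zipWith _∸_ t x)))
    ≡⟨ ℕΣ.∑-cong (listsOfLength L _) (λ x → x*[y*z]≡y*[x*z] (arrangement b x) (ind (x ≤*ᵇ t)) _) ⟩
  ∑ (listsOfLength L (upTo (suc (sum b)))) (λ x → ind (x ≤*ᵇ t) * (arrangement b x * W (zipWith _∸_ t x)))
    ≡⟨ ∑-lists-≤* t (suc (sum b)) (λ a c → arrangement b a * W c)
         (λ a c a≮ → cong (_* W c) (arrangement-bounded b a a≮)) ⟩
  (arrangement b ⋆ W) t ∎
  where
  open ≡-Reasoning
  L : ℕ
  L = length t
  W : RowFn
  W = ⋆-product (map arrangement bs)

nonzeros-positive : ∀ {l} → All (1 ≤_) l → nonzeros l ≡ l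
nonzeros-positive {l} pl = LP.filter-all (T? ∘ (1 ≤ᵇ_)) (All.map ℕP.≤⇒≤ᵇ pl)

restrict-nonzeros : ∀ u {β} → Positive β → nonzeros (restrict u β) ≡ restrict u β
restrict-nonzeros u pβ = nonzeros-positive (Perm.All-resp-↭ (↭-sym (sortDescℕ-↭ _))
  (AllP.map⁺ (AllP.filter⁺ _ (All.map proj₂ pβ))))

arrangements : ℕ → List SP → List RowFn
arrangements u βs = map (λ β → arrangement (restrict u β)) βs

sCount≡⋆-product : ∀ α βs u → All Positive βs → sCount α βs u ≡ ⋆-product (arrangements u βs) (restrict u α)
sCount≡⋆-product α βs u pβs = begin
  sCount α βs u
    ≡⟨ length-filterᵇ _ (cartesian (map (λ β → rowCandidates L (restrict u β)) βs)) ⟩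
  ∑ (cartesian (map (λ β → rowCandidates L (restrict u β)) βs)) (λ rows → ind (columnSums L rows ==ℕs a))
    ≡⟨ cong (λ l → ∑ (cartesian l) (λ rows → ind (columnSums L rows ==ℕs a))) (LP.map-∘ βs) ⟩
  matrixCount L (map (restrict u) βs) a
    ≡⟨ matrixCount≡⋆-product L (map (restrict u) βs) a refl (AllP.map⁺ (All.map (restrict-nonzeros u) pβs)) ⟩
  ⋆-product (map arrangement (map (restrict u) βs)) a
    ≡⟨ cong (λ ws → ⋆-product ws a) (LP.map-∘ βs) ⟨
  ⋆-product (arrangements u βs) a ∎
  where
  open ≡-Reasoning
  a : List ℕ
  a = restrict u α
  L : ℕ
  L = length a

rows : ∀ {D N} → Mono D N → List (List ℕ)
rows V.[] = []
rows (r V.∷ e) = V.toList r ∷ rows e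

rowAt : List (List ℕ) → ℕ → List ℕ
rowAt [] _ = []
rowAt (r ∷ rs) zero = r
rowAt (r ∷ rs) (suc j) = rowAt rs j

rowStacks : ℕ → List ℕ → SP
rowStacks u r = map (u ,_) (nonzeros r)

stacksFrom : ℕ → List (List ℕ) → SP
stacksFrom s [] = []
stacksFrom s (r ∷ rs) = rowStacks s r ++ stacksFrom (suc s) rs

monoType≡sortSP-stacksFrom : ∀ {D N} (e : Mono D N) → monoType e ≡ sortSP (stacksFrom 1 (rows e))
monoType≡sortSP-stacksFrom e = cong sortSP (concatMap-zip _ (λ _ _ → refl) 1 _ (λ _ → refl) e)
  where
  concatMap-zip : ∀ {D N} (F : ℕ × Vec ℕ N → SP) → (∀ u row → F (u , row) ≡ rowStacks u (V.toList row)) →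
    ∀ s (g : Fin D → ℕ) → (∀ i → g i ≡ s + toℕ i) → (e : Mono D N) →
    concatMap F (V.toList (V.zip (V.tabulate g) e)) ≡ stacksFrom s (rows e)
  concatMap-zip F F≡ s g g≡ V.[] = refl
  concatMap-zip F F≡ s g g≡ (r V.∷ e) = cong₂ _++_
    (trans (F≡ (g Fin.zero) r) (cong (λ u → rowStacks u (V.toList r)) (trans (g≡ Fin.zero) (ℕP.+-identityʳ s))))
    (concatMap-zip F F≡ (suc s) (g ∘ Fin.suc) (λ i → trans (g≡ (Fin.suc i)) (ℕP.+-suc s (toℕ i))) e)

monoType-↭ : ∀ {D N} (e : Mono D N) → monoType e ↭ stacksFrom 1 (rows e)
monoType-↭ e = subst (_↭ stacksFrom 1 (rows e)) (sym (monoType≡sortSP-stacksFrom e)) (sortSP-↭ _)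

stacksFrom-Positive : ∀ s rs → 1 ≤ s → Positive (stacksFrom s rs)
stacksFrom-Positive s [] _ = []
stacksFrom-Positive s (r ∷ rs) 1≤s = AllP.++⁺
  (AllP.map⁺ (All.map (λ 1≤k → 1≤s , 1≤k) (nonzeros-positive-entries r)))
  (stacksFrom-Positive (suc s) rs (ℕP.m≤n⇒m≤1+n 1≤s))
  where
  nonzeros-positive-entries : ∀ r → All (1 ≤_) (nonzeros r)
  nonzeros-positive-entries r = All.map (ℕP.≤ᵇ⇒≤ 1 _) (AllP.all-filter (T? ∘ (1 ≤ᵇ_)) r)

isStackPartition-monoType : ∀ n {D N} (e : Mono D N) → isStackPartition n (monoType e) ≡ (weight (monoType e) ≡ᵇ n)
isStackPartition-monoType n e = cong₂ (λ a b → a ∧ b ∧ (weight (monoType e) ≡ᵇ n))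
  (T⇒≡true (Positive⇒positiveStacks
    (Perm.All-resp-↭ (↭-sym (monoType-↭ e)) (stacksFrom-Positive 1 (rows e) ℕP.≤-refl))))
  (T⇒≡true (subst (T ∘ sortedDesc) (sym (monoType≡sortSP-stacksFrom e)) (sortedDesc-sortSP (stacksFrom 1 (rows e)))))

hasDegree : ℕ → Stack → Bool
hasDegree u x = proj₁ x ≡ᵇ u

multiplicities : ℕ → SP → List ℕ
multiplicities u β = map proj₂ (filterᵇ (hasDegree u) β)

without : ℕ → SP → SP
without u β = filterᵇ (not ∘ hasDegree u) β

module _ {u : ℕ} where
  filter-hasDegree-all : ∀ {xs} → All ((_≡ u) ∘ proj₁) xs → filterᵇ (hasDegree u) xs ≡ xs
  filter-hasDegree-all p = LP.filter-all (T? ∘ hasDegree u) (All.map (λ {x} eq → ℕP.≡⇒≡ᵇ (proj₁ x) u eq) p)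

  filter-hasDegree-none : ∀ {xs} → All ((_≢ u) ∘ proj₁) xs → filterᵇ (hasDegree u) xs ≡ []
  filter-hasDegree-none p = LP.filter-none (T? ∘ hasDegree u) (All.map (λ {x} ne → ne ∘ ℕP.≡ᵇ⇒≡ (proj₁ x) u) p)

  without-all : ∀ {xs} → All ((_≢ u) ∘ proj₁) xs → without u xs ≡ xs
  without-all p = LP.filter-all (T? ∘ (not ∘ hasDegree u)) (All.map ≢⇒T-not-≡ᵇ p)

  without-none : ∀ {xs} → All ((_≡ u) ∘ proj₁) xs → without u xs ≡ []
  without-none p = LP.filter-none (T? ∘ (not ∘ hasDegree u)) (All.map (λ d≡u h → T-not-≡ᵇ⇒≢ h d≡u) p)

rowStacks-degree : ∀ u r → All ((_≡ u) ∘ proj₁) (rowStacks u r)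
rowStacks-degree u r = AllP.map⁺ (All.universal (λ _ → refl) (nonzeros r))

stacksFrom-degree : ∀ s rs → All ((s ≤_) ∘ proj₁) (stacksFrom s rs)
stacksFrom-degree s [] = []
stacksFrom-degree s (r ∷ rs) = AllP.++⁺ (All.map (ℕP.≤-reflexive ∘ sym) (rowStacks-degree s r))
  (All.map (ℕP.≤-trans (ℕP.n≤1+n s)) (stacksFrom-degree (suc s) rs))

<-≤⇒≢ : ∀ {u s} → u < s → ∀ {d} → s ≤ d → d ≢ u
<-≤⇒≢ u<s s≤d refl = ℕP.<⇒≱ u<s s≤d

filter-hasDegree-stacksFrom : ∀ s r rs → filterᵇ (hasDegree s) (stacksFrom s (r ∷ rs)) ≡ rowStacks s r
filter-hasDegree-stacksFrom s r rs = begin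
  filterᵇ (hasDegree s) (rowStacks s r ++ stacksFrom (suc s) rs)
    ≡⟨ LP.filter-++ (T? ∘ hasDegree s) (rowStacks s r) _ ⟩
  filterᵇ (hasDegree s) (rowStacks s r) ++ filterᵇ (hasDegree s) (stacksFrom (suc s) rs)
    ≡⟨ cong₂ _++_ (filter-hasDegree-all (rowStacks-degree s r))
                  (filter-hasDegree-none (All.map (<-≤⇒≢ ℕP.≤-refl) (stacksFrom-degree (suc s) rs))) ⟩
  rowStacks s r ++ []
    ≡⟨ LP.++-identityʳ _ ⟩
  rowStacks s r ∎
  where open ≡-Reasoning

without-stacksFrom : ∀ s r rs → without s (stacksFrom s (r ∷ rs)) ≡ stacksFrom (suc s) rs
without-stacksFrom s r rs =
  trans (LP.filter-++ (T? ∘ (not ∘ hasDegree s)) (rowStacks s r) _)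
        (cong₂ _++_ (without-none (rowStacks-degree s r))
                    (without-all (All.map (<-≤⇒≢ ℕP.≤-refl) (stacksFrom-degree (suc s) rs))))

multiplicities-rowStacks : ∀ u r → map proj₂ (rowStacks u r) ≡ nonzeros r
multiplicities-rowStacks u r = trans (sym (LP.map-∘ (nonzeros r))) (LP.map-id (nonzeros r))

multiplicities-stacksFrom : ∀ s rs u → s ≤ u → multiplicities u (stacksFrom s rs) ≡ nonzeros (rowAt rs (u ∸ s))
multiplicities-stacksFrom s [] u _ = refl
multiplicities-stacksFrom s (r ∷ rs) u s≤u with ℕP.m≤n⇒m<n∨m≡n s≤u
... | inj₂ refl = trans (cong (map proj₂) (filter-hasDegree-stacksFrom s r rs))
  (trans (multiplicities-rowStacks s r) (cong (nonzeros ∘ rowAt (r ∷ rs)) (sym (ℕP.n∸n≡0 s))))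
... | inj₁ s<u = begin
  map proj₂ (filterᵇ (hasDegree u) (rowStacks s r ++ stacksFrom (suc s) rs))
    ≡⟨ cong (map proj₂) (LP.filter-++ (T? ∘ hasDegree u) (rowStacks s r) _) ⟩
  map proj₂ (filterᵇ (hasDegree u) (rowStacks s r) ++ filterᵇ (hasDegree u) (stacksFrom (suc s) rs))
    ≡⟨ cong (λ l → map proj₂ (l ++ filterᵇ (hasDegree u) (stacksFrom (suc s) rs)))
         (filter-hasDegree-none (All.map (λ { refl refl → ℕP.<-irrefl refl s<u }) (rowStacks-degree s r))) ⟩
  multiplicities u (stacksFrom (suc s) rs)
    ≡⟨ multiplicities-stacksFrom (suc s) rs u s<u ⟩
  nonzeros (rowAt rs (u ∸ suc s))
    ≡⟨ cong (nonzeros ∘ rowAt (r ∷ rs)) (ℕP.+-∸-assoc 1 s<u) ⟨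
  nonzeros (rowAt (r ∷ rs) (u ∸ s)) ∎
  where open ≡-Reasoning

matchesRows : ℕ → List (List ℕ) → SP → Bool
matchesRows s [] β = L.null β
matchesRows s (r ∷ rs) β = isArrangement (multiplicities s β) r ∧ matchesRows (suc s) rs (without s β)

map-,-proj₂ : ∀ {u} {xs : SP} → All ((_≡ u) ∘ proj₁) xs → map (u ,_) (map proj₂ xs) ≡ xs
map-,-proj₂ [] = refl
map-,-proj₂ {xs = (d , m) ∷ xs} (refl ∷ ps) = cong ((d , m) ∷_) (map-,-proj₂ ps)

stacksFrom-↭⇒matchesRows : ∀ s rs β → stacksFrom s rs ↭ β → T (matchesRows s rs β)
stacksFrom-↭⇒matchesRows s [] β p with Perm.↭-empty-inv (↭-sym p)
... | refl = tt
stacksFrom-↭⇒matchesRows s (r ∷ rs) β p =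
  T-∧⁺ (↭⇒isArrangement _ r nonzeros↭) (stacksFrom-↭⇒matchesRows (suc s) rs (without s β) rest↭)
  where
  nonzeros↭ : nonzeros r ↭ multiplicities s β
  nonzeros↭ = subst (_↭ multiplicities s β) (multiplicities-rowStacks s r)
    (Perm.map⁺ proj₂ (subst (_↭ _) (filter-hasDegree-stacksFrom s r rs) (Perm.filter-↭ (T? ∘ hasDegree s) p)))
  rest↭ : stacksFrom (suc s) rs ↭ without s β
  rest↭ = subst (_↭ without s β) (without-stacksFrom s r rs) (Perm.filter-↭ (T? ∘ (not ∘ hasDegree s)) p)

matchesRows⇒stacksFrom-↭ : ∀ s rs β → T (matchesRows s rs β) → stacksFrom s rs ↭ β
matchesRows⇒stacksFrom-↭ s [] [] _ = ↭-refl
matchesRows⇒stacksFrom-↭ s (r ∷ rs) β h =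
  ↭-trans (Perm.++⁺ degree-s rest) (↭-sym (↭-filterᵇ-partition (hasDegree s) β))
  where
  degree-s : rowStacks s r ↭ filterᵇ (hasDegree s) β
  degree-s = subst (rowStacks s r ↭_)
    (map-,-proj₂ (All.map (λ {x} → ℕP.≡ᵇ⇒≡ (proj₁ x) s) (AllP.all-filter (T? ∘ hasDegree s) β)))
    (Perm.map⁺ (s ,_) (isArrangement⇒↭ _ r (proj₁ (T-∧⁻ h))))
  rest : stacksFrom (suc s) rs ↭ without s β
  rest = matchesRows⇒stacksFrom-↭ (suc s) rs (without s β) (proj₂ (T-∧⁻ h))

coeffM≡matchesRows : ∀ {D N} {β} → T (sortedDesc β) → (a : Mono D N) → coeffM β a ≡ + ind (matchesRows 1 (rows a) β)
coeffM≡matchesRows {β = β} β↓ a = trans (indℤ (monoType a ==SP β)) (cong (+_ ∘ ind) (T-ext to from))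
  where
  to : T (monoType a ==SP β) → T (matchesRows 1 (rows a) β)
  to h = stacksFrom-↭⇒matchesRows 1 (rows a) β (sortSP-≡⇒↭ (trans (sym (monoType≡sortSP-stacksFrom a))
           (trans (==SP⇒≡ h) (sym (sortedDesc⇒sortSP-id β↓)))))
  from : T (matchesRows 1 (rows a) β) → T (monoType a ==SP β)
  from h = ≡⇒==SP (trans (monoType≡sortSP-stacksFrom a)
             (trans (sortSP-resp-↭ (matchesRows⇒stacksFrom-↭ 1 (rows a) β h)) (sortedDesc⇒sortSP-id β↓)))

-- Products of monomial symmetric functions

infixr 7 _⊛_

_⊛_ : ∀ {D N} → (Mono D N → ℕ) → (Mono D N → ℕ) → Mono D N → ℕ
(f ⊛ g) e = ∑ (splitsM e) (λ ab → f (proj₁ ab) * g (proj₂ ab))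

∑-splitsM-∷ : ∀ {D N} (r : Vec ℕ N) (e : Mono D N) (F : Mono (suc D) N × Mono (suc D) N → ℕ) →
  ∑ (splitsM (r V.∷ e)) F ≡
  ∑ (splitsV r) (λ p → ∑ (splitsM e) (λ q → F (proj₁ p V.∷ proj₁ q , proj₂ p V.∷ proj₂ q)))
∑-splitsM-∷ r e F = trans (ℕΣ.∑-concatMap _ (splitsV r) F) (ℕΣ.∑-cong (splitsV r) (λ p → ℕΣ.∑-map _ (splitsM e) F))

∑-splitsV : ∀ {N} (r : Vec ℕ N) (F : List ℕ → List ℕ → ℕ) →
  ∑ (splitsV r) (λ p → F (V.toList (proj₁ p)) (V.toList (proj₂ p))) ≡
  ∑ (splits (V.toList r)) (λ ab → F (proj₁ ab) (proj₂ ab))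
∑-splitsV V.[] F = refl
∑-splitsV (k V.∷ r) F = begin
  ∑ (splitsV (k V.∷ r)) (λ p → F (V.toList (proj₁ p)) (V.toList (proj₂ p)))
    ≡⟨ ℕΣ.∑-concatMap (λ i → map (cons i) (splitsV r)) (upTo (suc k)) G ⟩
  ∑ (upTo (suc k)) (λ i → ∑ (map (cons i) (splitsV r)) G)
    ≡⟨ ℕΣ.∑-cong (upTo (suc k)) (λ i →
         trans (ℕΣ.∑-map (cons i) (splitsV r) G) (∑-splitsV r (λ a b → F (i ∷ a) ((k ∸ i) ∷ b)))) ⟩
  ∑ (upTo (suc k)) (λ i → ∑ (splits (V.toList r)) (λ ab → F (i ∷ proj₁ ab) ((k ∸ i) ∷ proj₂ ab)))
    ≡⟨ ∑-splits-∷ k (V.toList r) _ ⟨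
  ∑ (splits (k ∷ V.toList r)) (λ ab → F (proj₁ ab) (proj₂ ab)) ∎
  where
  open ≡-Reasoning
  cons : ℕ → Vec ℕ _ × Vec ℕ _ → Vec ℕ _ × Vec ℕ _
  cons i p = (i V.∷ proj₁ p , (k ∸ i) V.∷ proj₂ p)
  G : Vec ℕ _ × Vec ℕ _ → ℕ
  G p = F (V.toList (proj₁ p)) (V.toList (proj₂ p))

⊛-∷ : ∀ {D N} {f g : Mono (suc D) N → ℕ} {f₁ g₁ : RowFn} {f₂ g₂ : Mono D N → ℕ} →
  (∀ r e → f (r V.∷ e) ≡ f₁ (V.toList r) * f₂ e) → (∀ r e → g (r V.∷ e) ≡ g₁ (V.toList r) * g₂ e) →
  ∀ r e → (f ⊛ g) (r V.∷ e) ≡ (f₁ ⋆ g₁) (V.toList r) * (f₂ ⊛ g₂) e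
⊛-∷ {f = f} {g} {f₁} {g₁} {f₂} {g₂} f≡ g≡ r e = begin
  (f ⊛ g) (r V.∷ e)
    ≡⟨ ∑-splitsM-∷ r e _ ⟩
  ∑ (splitsV r) (λ p → ∑ (splitsM e) (λ q → f (proj₁ p V.∷ proj₁ q) * g (proj₂ p V.∷ proj₂ q)))
    ≡⟨ ℕΣ.∑-cong (splitsV r) (λ p → ℕΣ.∑-cong (splitsM e) (λ q →
         trans (cong₂ _*_ (f≡ (proj₁ p) (proj₁ q)) (g≡ (proj₂ p) (proj₂ q)))
               (*-interchange (f₁ (V.toList (proj₁ p))) (f₂ (proj₁ q)) (g₁ (V.toList (proj₂ p))) (g₂ (proj₂ q))))) ⟩
  ∑ (splitsV r) (λ p → ∑ (splitsM e) (λ q → (R₁ p) * (f₂ (proj₁ q) * g₂ (proj₂ q))))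
    ≡⟨ ℕΣ.∑-cong (splitsV r) (λ p → sym (ℕΣ.∑-*ˡ (R₁ p) (splitsM e) _)) ⟩
  ∑ (splitsV r) (λ p → R₁ p * (f₂ ⊛ g₂) e)
    ≡⟨ ℕΣ.∑-*ʳ ((f₂ ⊛ g₂) e) (splitsV r) R₁ ⟨
  ∑ (splitsV r) R₁ * (f₂ ⊛ g₂) e
    ≡⟨ cong (_* (f₂ ⊛ g₂) e) (∑-splitsV r (λ a b → f₁ a * g₁ b)) ⟩
  (f₁ ⋆ g₁) (V.toList r) * (f₂ ⊛ g₂) e ∎
  where
  open ≡-Reasoning
  R₁ : Vec ℕ _ × Vec ℕ _ → ℕ
  R₁ p = f₁ (V.toList (proj₁ p)) * g₁ (V.toList (proj₂ p))

rowMatchProduct : ∀ {D N} → ℕ → List SP → Mono D N → ℕ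
rowMatchProduct s [] e = ind (allZero e)
rowMatchProduct s (β ∷ βs) = (λ a → ind (matchesRows s (rows a) β)) ⊛ rowMatchProduct s βs

ind-all-≡ᵇ0 : ∀ l → ind (Bool.all (_≡ᵇ 0) l) ≡ δ₀ l
ind-all-≡ᵇ0 [] = refl
ind-all-≡ᵇ0 (zero ∷ l) = ind-all-≡ᵇ0 l
ind-all-≡ᵇ0 (suc _ ∷ l) = refl

allZero-∷ : ∀ {D N} (r : Vec ℕ N) (e : Mono D N) → ind (allZero (r V.∷ e)) ≡ δ₀ (V.toList r) * ind (allZero e)
allZero-∷ r e = trans (ind-∧ (Bool.all (_≡ᵇ 0) (V.toList r)) (allZero e))
                      (cong (_* ind (allZero e)) (ind-all-≡ᵇ0 (V.toList r)))

matchesRows-∷ : ∀ {D N} s β (r : Vec ℕ N) (e : Mono D N) →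
  ind (matchesRows s (rows (r V.∷ e)) β) ≡
  arrangement (restrict s β) (V.toList r) * ind (matchesRows (suc s) (rows e) (without s β))
matchesRows-∷ s β r e = trans (ind-∧ (isArrangement (multiplicities s β) (V.toList r)) _)
  (cong (λ b → ind b * ind (matchesRows (suc s) (rows e) (without s β)))
        (isArrangement-resp-↭ (↭-sym (sortDescℕ-↭ (multiplicities s β))) (V.toList r)))

rowMatchProduct-∷ : ∀ {D N} s βs (r : Vec ℕ N) (e : Mono D N) →
  rowMatchProduct s βs (r V.∷ e) ≡
  ⋆-product (arrangements s βs) (V.toList r) * rowMatchProduct (suc s) (map (without s) βs) e
rowMatchProduct-∷ s [] = allZero-∷
rowMatchProduct-∷ s (β ∷ βs) =
  ⊛-∷ {f = λ a → ind (matchesRows s (rows a) β)} {g = rowMatchProduct s βs}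
      {f₁ = arrangement (restrict s β)} {g₁ = ⋆-product (arrangements s βs)}
      {f₂ = λ a → ind (matchesRows (suc s) (rows a) (without s β))} {g₂ = rowMatchProduct (suc s) (map (without s) βs)}
      (matchesRows-∷ s β) (rowMatchProduct-∷ s βs)

rowMatchProduct-[] : ∀ {N} s βs → rowMatchProduct {0} {N} s βs V.[] ≡ product (map (ind ∘ L.null) βs)
rowMatchProduct-[] s [] = refl
rowMatchProduct-[] s (β ∷ βs) = trans (ℕP.+-identityʳ _) (cong (ind (L.null β) *_) (rowMatchProduct-[] s βs))

filter-hasDegree-without : ∀ {u s} → u ≢ s → ∀ β → filterᵇ (hasDegree u) (without s β) ≡ filterᵇ (hasDegree u) β
filter-hasDegree-without {u} {s} u≢s = filterᵇ-filterᵇ λ x d≡u →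
  ≢⇒T-not-≡ᵇ (λ d≡s → u≢s (trans (sym (ℕP.≡ᵇ⇒≡ (proj₁ x) u d≡u)) d≡s))

arrangements-without : ∀ {u s} → u ≢ s → ∀ βs → arrangements u (map (without s) βs) ≡ arrangements u βs
arrangements-without u≢s βs = trans (sym (LP.map-∘ βs))
  (LP.map-cong (λ β → cong (arrangement ∘ sortDescℕ ∘ map proj₂) (filter-hasDegree-without u≢s β)) βs)

==ℕs-[]-sortDescℕ : ∀ l → ([] ==ℕs sortDescℕ l) ≡ L.null l
==ℕs-[]-sortDescℕ [] = refl
==ℕs-[]-sortDescℕ (x ∷ l) = ¬T⇒≡false λ h →
  ℕP.0≢1+n (Perm.↭-length (subst (_↭ x ∷ l) (sym (==ℕs⇒≡ {[]} {sortDescℕ (x ∷ l)} h)) (sortDescℕ-↭ (x ∷ l))))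

emptyAt : ℕ → SP → ℕ
emptyAt u β = ind (L.null (filterᵇ (hasDegree u) β))

arrangement-restrict-[] : ∀ u β → arrangement (restrict u β) [] ≡ emptyAt u β
arrangement-restrict-[] u β = cong ind (trans (cong ([] ==ℕs_) (sortDescℕ-idem (multiplicities u β)))
  (trans (==ℕs-[]-sortDescℕ (multiplicities u β)) (null-map (filterᵇ (hasDegree u) β))))
  where
  null-map : ∀ (xs : SP) → L.null (map proj₂ xs) ≡ L.null xs
  null-map [] = refl
  null-map (_ ∷ _) = refl

productFrom : ℕ → ℕ → (ℕ → ℕ) → ℕ
productFrom s zero f = 1
productFrom s (suc M) f = f s * productFrom (suc s) M f

productFrom-cong : ∀ s M {f g : ℕ → ℕ} → (∀ u → s ≤ u → u < s + M → f u ≡ g u) → productFrom s M f ≡ productFrom s M g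
productFrom-cong s zero f≡g = refl
productFrom-cong s (suc M) f≡g = cong₂ _*_
  (f≡g s ℕP.≤-refl (subst (s <_) (sym (ℕP.+-suc s M)) (s≤s (ℕP.m≤m+n s M))))
  (productFrom-cong (suc s) M (λ u s<u u<ss+M → f≡g u (ℕP.<⇒≤ s<u) (subst (u <_) (sym (ℕP.+-suc s M)) u<ss+M)))

productFrom-* : ∀ s M (f g : ℕ → ℕ) → productFrom s M (λ u → f u * g u) ≡ productFrom s M f * productFrom s M g
productFrom-* s zero f g = refl
productFrom-* s (suc M) f g = trans (cong (f s * g s *_) (productFrom-* (suc s) M f g)) (*-interchange (f s) (g s) _ _)

productFrom-1 : ∀ s M → productFrom s M (λ _ → 1) ≡ 1
productFrom-1 s zero = refl
productFrom-1 s (suc M) = trans (ℕP.+-identityʳ _) (productFrom-1 (suc s) M)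

productFrom-product : ∀ {A : Set} s M (g : ℕ → A → ℕ) xs →
  productFrom s M (λ u → product (map (g u) xs)) ≡ product (map (λ x → productFrom s M (λ u → g u x)) xs)
productFrom-product s M g [] = productFrom-1 s M
productFrom-product s M g (x ∷ xs) = trans (productFrom-* s M (λ u → g u x) _)
  (cong (productFrom s M (λ u → g u x) *_) (productFrom-product s M g xs))

productFrom-extend : ∀ s M k (f : ℕ → ℕ) → (∀ u → s + M ≤ u → f u ≡ 1) → productFrom s (M + k) f ≡ productFrom s M f
productFrom-extend s zero k f f≡1 = trans
  (productFrom-cong s k (λ u s≤u _ → f≡1 u (subst (_≤ u) (sym (ℕP.+-identityʳ s)) s≤u))) (productFrom-1 s k)
productFrom-extend s (suc M) k f f≡1 =
  cong (f s *_) (productFrom-extend (suc s) M k f (λ u s+M<u → f≡1 u (subst (_≤ u) (sym (ℕP.+-suc s M)) s+M<u)))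

product-upTo1 : ∀ (f : ℕ → ℕ) n → product (map f (upTo1 n)) ≡ productFrom 1 n f
product-upTo1 f n = trans (cong (product ∘ map f) (LP.map-upTo suc n)) (go n 1 suc (λ _ → refl))
  where
  go : ∀ n s (h : ℕ → ℕ) → (∀ i → h i ≡ s + i) → product (map f (applyUpTo h n)) ≡ productFrom s n f
  go zero s h h≡ = refl
  go (suc n) s h h≡ = cong₂ _*_ (cong f (trans (h≡ 0) (ℕP.+-identityʳ s)))
    (go n (suc s) (h ∘ suc) (λ i → trans (h≡ (suc i)) (ℕP.+-suc s i)))

DegreesIn : ℕ → ℕ → SP → Set
DegreesIn s M = All (λ x → s ≤ proj₁ x × proj₁ x < s + M)

DegreesIn-without : ∀ {s M β} → DegreesIn s (suc M) β → DegreesIn (suc s) M (without s β)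
DegreesIn-without {s} {M} {β} dβ = All.map
  (λ { {d , _} (d≢s , s≤d , d<) → ℕP.≤∧≢⇒< s≤d (λ s≡d → T-not-≡ᵇ⇒≢ d≢s (sym s≡d)) , subst (d <_) (ℕP.+-suc s M) d< })
  (All.zip (AllP.all-filter (T? ∘ (not ∘ hasDegree s)) β , AllP.filter⁺ (T? ∘ (not ∘ hasDegree s)) dβ))

productFrom-emptyAt : ∀ s M β → DegreesIn s M β → productFrom s M (λ u → emptyAt u β) ≡ ind (L.null β)
productFrom-emptyAt s zero [] _ = refl
productFrom-emptyAt s zero (_ ∷ _) ((s≤d , d<s+0) ∷ _) =
  ⊥-elim (ℕP.<-irrefl refl (ℕP.<-≤-trans d<s+0 (subst (_≤ _) (sym (ℕP.+-identityʳ s)) s≤d)))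
productFrom-emptyAt s (suc M) β dβ = begin
  emptyAt s β * productFrom (suc s) M (λ u → emptyAt u β)
    ≡⟨ cong (emptyAt s β *_) (productFrom-cong (suc s) M (λ u s<u _ →
         cong (ind ∘ L.null) (sym (filter-hasDegree-without (λ u≡s → ℕP.<-irrefl (sym u≡s) s<u) β)))) ⟩
  emptyAt s β * productFrom (suc s) M (λ u → emptyAt u (without s β))
    ≡⟨ cong (emptyAt s β *_) (productFrom-emptyAt (suc s) M (without s β) (DegreesIn-without dβ)) ⟩
  emptyAt s β * ind (L.null (without s β))
    ≡⟨ null-partition (hasDegree s) β ⟩
  ind (L.null β) ∎
  where open ≡-Reasoning

rowMatchProduct≡productFrom : ∀ {D N} s M (e : Mono D N) βs → D ≤ M → All (DegreesIn s M) βs →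
  rowMatchProduct s βs e ≡ productFrom s M (λ u → ⋆-product (arrangements u βs) (rowAt (rows e) (u ∸ s)))
rowMatchProduct≡productFrom s M V.[] βs _ dβs = begin
  rowMatchProduct s βs V.[]
    ≡⟨ rowMatchProduct-[] s βs ⟩
  product (map (ind ∘ L.null) βs)
    ≡⟨ product-map-cong-All dβs (λ {β} → productFrom-emptyAt s M β) ⟨
  product (map (λ β → productFrom s M (λ u → emptyAt u β)) βs)
    ≡⟨ productFrom-product s M emptyAt βs ⟨
  productFrom s M (λ u → product (map (emptyAt u) βs))
    ≡⟨ productFrom-cong s M (λ u _ _ → sym (trans (⋆-product-[] (arrangements u βs))
         (cong product (trans (sym (LP.map-∘ βs)) (LP.map-cong (arrangement-restrict-[] u) βs))))) ⟩
  productFrom s M (λ u → ⋆-product (arrangements u βs) []) ∎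
  where open ≡-Reasoning
rowMatchProduct≡productFrom s zero (r V.∷ e) βs () _
rowMatchProduct≡productFrom s (suc M) (r V.∷ e) βs (s≤s D≤M) dβs = begin
  rowMatchProduct s βs (r V.∷ e)
    ≡⟨ rowMatchProduct-∷ s βs r e ⟩
  ⋆-product (arrangements s βs) (V.toList r) * rowMatchProduct (suc s) (map (without s) βs) e
    ≡⟨ cong (⋆-product (arrangements s βs) (V.toList r) *_)
         (rowMatchProduct≡productFrom (suc s) M e (map (without s) βs) D≤M (AllP.map⁺ (All.map DegreesIn-without dβs))) ⟩
  ⋆-product (arrangements s βs) (V.toList r) *
  productFrom (suc s) M (λ u → ⋆-product (arrangements u (map (without s) βs)) (rowAt (rows e) (u ∸ suc s)))
    ≡⟨ cong₂ _*_ (cong (⋆-product (arrangements s βs) ∘ rowAt (rows (r V.∷ e))) (sym (ℕP.n∸n≡0 s)))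
         (productFrom-cong (suc s) M (λ u s<u _ → cong₂ ⋆-product
           (arrangements-without (λ u≡s → ℕP.<-irrefl (sym u≡s) s<u) βs)
           (cong (rowAt (rows (r V.∷ e))) (sym (ℕP.+-∸-assoc 1 s<u))))) ⟩
  productFrom s (suc M) (λ u → ⋆-product (arrangements u βs) (rowAt (rows (r V.∷ e)) (u ∸ s))) ∎
  where open ≡-Reasoning

restrict-monoType : ∀ {D N} (e : Mono D N) u → 1 ≤ u → restrict u (monoType e) ↭ nonzeros (rowAt (rows e) (u ∸ 1))
restrict-monoType e u 1≤u = ↭-trans (sortDescℕ-↭ _)
  (subst (multiplicities u (monoType e) ↭_) (multiplicities-stacksFrom 1 (rows e) u 1≤u)
         (Perm.map⁺ proj₂ (Perm.filter-↭ (T? ∘ hasDegree u) (monoType-↭ e))))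

rowFactor≡sCount : ∀ {D N} (e : Mono D N) βs u → 1 ≤ u → All Positive βs →
  ⋆-product (arrangements u βs) (rowAt (rows e) (u ∸ 1)) ≡ sCount (monoType e) βs u
rowFactor≡sCount e βs u 1≤u pβs = begin
  ⋆-product (arrangements u βs) (rowAt (rows e) (u ∸ 1))
    ≡⟨ ⋆-product-ZeroInvariant (AllP.map⁺ (All.universal (arrangement-ZeroInvariant ∘ restrict u) βs)) _ ⟩
  ⋆-product (arrangements u βs) (nonzeros (rowAt (rows e) (u ∸ 1)))
    ≡⟨ ⋆-product-PermInvariant (AllP.map⁺ (All.universal (arrangement-PermInvariant ∘ restrict u) βs))
         (restrict-monoType e u 1≤u) ⟨
  ⋆-product (arrangements u βs) (restrict u (monoType e))
    ≡⟨ sCount≡⋆-product (monoType e) βs u pβs ⟨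
  sCount (monoType e) βs u ∎
  where open ≡-Reasoning

degrees-≤-degSum : ∀ τ → All ((_≤ degSum τ) ∘ proj₁) τ
degrees-≤-degSum τ = AllP.map⁻ (All-≤-sum (map proj₁ τ))

restrict-beyond : ∀ u τ → degSum τ < u → restrict u τ ≡ []
restrict-beyond u τ τ<u = cong (sortDescℕ ∘ map proj₂)
  (filter-hasDegree-none (All.map (λ d≤ d≡u → ℕP.<-irrefl d≡u (ℕP.≤-<-trans d≤ τ<u)) (degrees-≤-degSum τ)))

sCount-beyond : ∀ α βs u → All Positive βs → degSum α < u → All (λ β → degSum β < u) βs → sCount α βs u ≡ 1
sCount-beyond α βs u pβs α<u βs<u = begin
  sCount α βs u
    ≡⟨ sCount≡⋆-product α βs u pβs ⟩
  ⋆-product (arrangements u βs) (restrict u α)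
    ≡⟨ cong (⋆-product (arrangements u βs)) (restrict-beyond u α α<u) ⟩
  ⋆-product (arrangements u βs) []
    ≡⟨ ⋆-product-[] (arrangements u βs) ⟩
  product (map (λ f → f []) (arrangements u βs))
    ≡⟨ cong product (LP.map-∘ βs) ⟨
  product (map (λ β → arrangement (restrict u β) []) βs)
    ≡⟨ product-map-1 (All.map (λ {β} β<u → cong (λ b → arrangement b []) (restrict-beyond u β β<u)) βs<u) ⟩
  1 ∎
  where open ≡-Reasoning

-- The window of degrees 1 … B + D covers both the degrees occurring in α and the βs and the D rows of the
-- monomial; beyond B every factor is 1.
rowMatchProduct≡calS : ∀ {D N} (e : Mono D N) βs → All Positive βs → rowMatchProduct 1 βs e ≡ calS (monoType e) βs
rowMatchProduct≡calS {D} e βs pβs = begin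
  rowMatchProduct 1 βs e
    ≡⟨ rowMatchProduct≡productFrom 1 (B + D) e βs (ℕP.m≤n+m D B) degreesIn ⟩
  productFrom 1 (B + D) (λ u → ⋆-product (arrangements u βs) (rowAt (rows e) (u ∸ 1)))
    ≡⟨ productFrom-cong 1 (B + D) (λ u 1≤u _ → rowFactor≡sCount e βs u 1≤u pβs) ⟩
  productFrom 1 (B + D) (sCount α βs)
    ≡⟨ productFrom-extend 1 B D (sCount α βs) (λ u B<u → sCount-beyond α βs u pβs
         (ℕP.<-≤-trans (s≤s (ℕP.m≤m+n (degSum α) _)) B<u) (All.map (λ {β} le → βs<u {β} le B<u) degSum-βs)) ⟩
  productFrom 1 B (sCount α βs)
    ≡⟨ product-upTo1 (sCount α βs) B ⟨
  calS α βs ∎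
  where
  open ≡-Reasoning
  α : SP
  α = monoType e
  B : ℕ
  B = degSum α + sum (map degSum βs)
  degSum-βs : All (λ β → degSum β ≤ sum (map degSum βs)) βs
  degSum-βs = AllP.map⁻ (All-≤-sum (map degSum βs))
  βs<u : ∀ {β u} → degSum β ≤ sum (map degSum βs) → suc B ≤ u → degSum β < u
  βs<u le B<u = ℕP.<-≤-trans (s≤s (ℕP.≤-trans le (ℕP.m≤n+m _ (degSum α)))) B<u
  degreesIn : All (DegreesIn 1 (B + D)) βs
  degreesIn = All.map (λ { {β} (pβ , le) → All.map (λ { ((1≤d , _) , d≤) →
      1≤d , s≤s (ℕP.≤-trans d≤ (ℕP.≤-trans le (ℕP.≤-trans (ℕP.m≤n+m _ (degSum α)) (ℕP.m≤m+n B D)))) })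
    (All.zip (pβ , degrees-≤-degSum β)) }) (All.zip (pβs , degSum-βs))

∏M : ∀ {D N} → List SP → Series D N
∏M [] = oneS
∏M (β ∷ βs) = mulS (coeffM β) (∏M βs)

+-∑ : ∀ {A : Set} (xs : List A) (f : A → ℕ) → + ∑ xs f ≡ ℤΣ.∑ xs (λ x → + f x)
+-∑ [] f = refl
+-∑ (x ∷ xs) f = trans (ℤP.pos-+ (f x) _) (cong (+ f x +ℤ_) (+-∑ xs f))

∏M≡rowMatchProduct : ∀ {D N} {βs} → All (T ∘ sortedDesc) βs → (e : Mono D N) → ∏M βs e ≡ + rowMatchProduct 1 βs e
∏M≡rowMatchProduct [] e = indℤ (allZero e)
∏M≡rowMatchProduct {βs = β ∷ βs} (β↓ ∷ βs↓) e = begin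
  ℤΣ.∑ (splitsM e) (λ ab → coeffM β (proj₁ ab) *ℤ ∏M βs (proj₂ ab))
    ≡⟨ ℤΣ.∑-cong (splitsM e) (λ ab → trans
         (cong₂ _*ℤ_ (coeffM≡matchesRows β↓ (proj₁ ab)) (∏M≡rowMatchProduct βs↓ (proj₂ ab)))
         (sym (ℤP.pos-* (ind (matchesRows 1 (rows (proj₁ ab)) β)) _))) ⟩
  ℤΣ.∑ (splitsM e) (λ ab → + (ind (matchesRows 1 (rows (proj₁ ab)) β) * rowMatchProduct 1 βs (proj₂ ab)))
    ≡⟨ +-∑ (splitsM e) _ ⟨
  + rowMatchProduct 1 (β ∷ βs) e ∎
  where open ≡-Reasoning

SortedPositive : SP → Set
SortedPositive β = T (sortedDesc β) × Positive β

∏M≡calS : ∀ {D N} {βs} → All SortedPositive βs → (e : Mono D N) → ∏M βs e ≡ + calS (monoType e) βs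
∏M≡calS spβs e = trans (∏M≡rowMatchProduct (All.map proj₁ spβs) e)
                       (cong +_ (rowMatchProduct≡calS e _ (All.map proj₂ spβs)))

-- The substitution x ↦ xᵐ

scale : ℕ → Stack → Stack
scale m x = (proj₁ x , m * proj₂ x)

scale-mono : ∀ m x y → T (x ≥ˢ y) → T (scale m x ≥ˢ scale m y)
scale-mono m (d , j) (d' , j') h with ≥ˢ⇒Lex≥ (d , j) (d' , j') h
... | inj₁ d'<d = Lex≥⇒≥ˢ (d , m * j) (d' , m * j') (inj₁ d'<d)
... | inj₂ (d≡d' , j'≤j) = Lex≥⇒≥ˢ (d , m * j) (d' , m * j') (inj₂ (d≡d' , ℕP.*-monoʳ-≤ m j'≤j))

sortSP-scale : ∀ m l → sortSP (map (scale m) l) ≡ map (scale m) (sortSP l)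
sortSP-scale m = sortSP-map (λ {x} {y} → scale-mono m x y)

divisible : ∀ {D N} (m : ℕ) .{{_ : ℕ.NonZero m}} → Mono D N → Bool
divisible m e = Bool.all (λ row → Bool.all (λ x → (x % m) ≡ᵇ 0) (V.toList row)) (V.toList e)

divided : ∀ {D N} (m : ℕ) .{{_ : ℕ.NonZero m}} → Mono D N → Mono D N
divided m e = V.map (V.map (λ x → x / m)) e

module _ (k : ℕ) where
  private
    m : ℕ
    m = suc k

  scale-injective : ∀ {x y} → scale m x ≡ scale m y → x ≡ y
  scale-injective {d , j} {d' , j'} eq = cong₂ _,_ (cong proj₁ eq) (ℕP.*-cancelˡ-≡ j j' m (cong proj₂ eq))

  nonzeros-scale : ∀ r → nonzeros (map (m *_) r) ≡ map (m *_) (nonzeros r)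
  nonzeros-scale [] = refl
  nonzeros-scale (zero ∷ r) rewrite ℕP.*-zeroʳ k = nonzeros-scale r
  nonzeros-scale (suc x ∷ r) = cong (m * suc x ∷_) (nonzeros-scale r)

  stacksFrom-scale : ∀ s rs → stacksFrom s (map (map (m *_)) rs) ≡ map (scale m) (stacksFrom s rs)
  stacksFrom-scale s [] = refl
  stacksFrom-scale s (r ∷ rs) = trans
    (cong₂ _++_ (trans (cong (map (s ,_)) (nonzeros-scale r)) (trans (sym (LP.map-∘ (nonzeros r))) (LP.map-∘ _)))
                (stacksFrom-scale (suc s) rs))
    (sym (LP.map-++ (scale m) (rowStacks s r) _))

  powSub-divisible : ∀ {D N} (f : Series D N) e → T (divisible m e) → powSub m f e ≡ f (divided m e)
  powSub-divisible f e h rewrite T⇒≡true h = refl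

  powSub-indivisible : ∀ {D N} (f : Series D N) e → ¬ T (divisible m e) → powSub m f e ≡ + 0
  powSub-indivisible f e h rewrite ¬T⇒≡false h = refl

  rows-divided : ∀ {D N} (e : Mono D N) → T (divisible m e) → rows e ≡ map (map (m *_)) (rows (divided m e))
  rows-divided V.[] _ = refl
  rows-divided (r V.∷ e) h = cong₂ _∷_ (row-divided r (proj₁ (T-∧⁻ h))) (rows-divided e (proj₂ (T-∧⁻ h)))
    where
    row-divided : ∀ {N} (r : Vec ℕ N) → T (Bool.all (λ x → (x % m) ≡ᵇ 0) (V.toList r)) →
                  V.toList r ≡ map (m *_) (V.toList (V.map (λ x → x / m) r))
    row-divided V.[] _ = refl
    row-divided (x V.∷ r) h = cong₂ _∷_ x≡m*[x/m] (row-divided r (proj₂ (T-∧⁻ h)))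
      where
      x≡m*[x/m] : x ≡ m * (x / m)
      x≡m*[x/m] = trans (m≡m%n+[m/n]*n x m)
        (trans (cong (_+ (x / m) * m) (ℕP.≡ᵇ⇒≡ _ 0 (proj₁ (T-∧⁻ h)))) (ℕP.*-comm (x / m) m))

  monoType-divided : ∀ {D N} (e : Mono D N) → T (divisible m e) → monoType e ≡ map (scale m) (monoType (divided m e))
  monoType-divided e h = begin
    monoType e                                                  ≡⟨ monoType≡sortSP-stacksFrom e ⟩
    sortSP (stacksFrom 1 (rows e))                              ≡⟨ cong (sortSP ∘ stacksFrom 1) (rows-divided e h) ⟩
    sortSP (stacksFrom 1 (map (map (m *_)) (rows e/m)))         ≡⟨ cong sortSP (stacksFrom-scale 1 (rows e/m)) ⟩
    sortSP (map (scale m) (stacksFrom 1 (rows e/m)))            ≡⟨ sortSP-scale m (stacksFrom 1 (rows e/m)) ⟩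
    map (scale m) (sortSP (stacksFrom 1 (rows e/m)))            ≡⟨ cong (map (scale m)) (monoType≡sortSP-stacksFrom e/m) ⟨
    map (scale m) (monoType e/m)                                ∎
    where
    open ≡-Reasoning
    e/m : Mono _ _
    e/m = divided m e

  stacksFrom-divisible : ∀ {D N} s (e : Mono D N) → All ((_≡ 0) ∘ (_% m) ∘ proj₂) (stacksFrom s (rows e)) →
                         T (divisible m e)
  stacksFrom-divisible s V.[] _ = tt
  stacksFrom-divisible s (r V.∷ e) h = let (hr , he) = AllP.++⁻ (rowStacks s (V.toList r)) h in
    T-∧⁺ (row (V.toList r) (All-nonzeros⁻ refl (V.toList r) (AllP.map⁻ hr))) (stacksFrom-divisible (suc s) e he)
    where
    row : ∀ l → All ((_≡ 0) ∘ (_% m)) l → T (Bool.all (λ x → (x % m) ≡ᵇ 0) l)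
    row [] [] = tt
    row (x ∷ l) (x%m≡0 ∷ pl) = T-∧⁺ (ℕP.≡⇒≡ᵇ _ 0 x%m≡0) (row l pl)

  powSub-coeffM : ∀ σ {D N} (e : Mono D N) → powSub m (coeffM σ) e ≡ coeffM (σ ^ˢ m) e
  powSub-coeffM σ e with T? (divisible m e)
  ... | yes div = trans (powSub-divisible (coeffM σ) e div) (cong (λ b → if b then + 1 else + 0) (T-ext to from))
    where
    to : T (monoType (divided m e) ==SP σ) → T (monoType e ==SP (σ ^ˢ m))
    to h = ≡⇒==SP (trans (monoType-divided e div) (cong (map (scale m)) (==SP⇒≡ h)))
    from : T (monoType e ==SP (σ ^ˢ m)) → T (monoType (divided m e) ==SP σ)
    from h = ≡⇒==SP (LP.map-injective scale-injective (trans (sym (monoType-divided e div)) (==SP⇒≡ h)))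
  ... | no ¬div =
    trans (powSub-indivisible (coeffM σ) e ¬div) (sym (cong (λ b → if b then + 1 else + 0) (¬T⇒≡false not-type)))
    where
    multiples : All ((_≡ 0) ∘ (_% m) ∘ proj₂) (σ ^ˢ m)
    multiples = AllP.map⁺ (All.universal (λ x →
      trans (cong (_% m) (ℕP.*-comm m (proj₂ x))) (m*n%n≡0 (proj₂ x) m)) σ)
    not-type : ¬ T (monoType e ==SP (σ ^ˢ m))
    not-type h = ¬div (stacksFrom-divisible 1 e
      (Perm.All-resp-↭ (monoType-↭ e) (subst (All _) (sym (==SP⇒≡ h)) multiples)))

  powSub-∑ : ∀ {A : Set} {D N} (xs : List A) (c : A → ℤ) (F : A → Series D N) e →
    powSub m (λ a → ℤΣ.∑ xs (λ x → c x *ℤ F x a)) e ≡ ℤΣ.∑ xs (λ x → c x *ℤ powSub m (F x) e)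
  powSub-∑ xs c F e with T? (divisible m e)
  ... | yes div = trans (powSub-divisible (λ a → ℤΣ.∑ xs (λ x → c x *ℤ F x a)) e div)
    (ℤΣ.∑-cong xs (λ x → cong (c x *ℤ_) (sym (powSub-divisible (F x) e div))))
  ... | no ¬div = trans (powSub-indivisible (λ a → ℤΣ.∑ xs (λ x → c x *ℤ F x a)) e ¬div)
    (sym (ℤΣ.∑-zero xs (λ x → trans (cong (c x *ℤ_) (powSub-indivisible (F x) e ¬div)) (ℤP.*-zeroʳ (c x)))))

-- Expanding H⁺_τ

signOf : List SP → ℤ
signOf σs = foldr _*ℤ_ (+ 1) (map (λ σ → sign (area σ)) σs)

powers : SP → List SP → List SP
powers τ σs = zipWith (λ { (d , m) σ → σ ^ˢ m }) τ σs

tuples : SP → List (List SP)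
tuples τ = cartesian (map (λ { (d , m) → stackPartitions d }) τ)

mulS-cong : ∀ {D N} {f f' g g' : Series D N} → (∀ a → f a ≡ f' a) → (∀ b → g b ≡ g' b) → ∀ e → mulS f g e ≡ mulS f' g' e
mulS-cong f≗f' g≗g' e = ℤΣ.∑-cong (splitsM e) (λ ab → cong₂ _*ℤ_ (f≗f' (proj₁ ab)) (g≗g' (proj₂ ab)))

mulS-∑ : ∀ {A B : Set} {D N} (xs : List A) (ys : List B) (a : A → ℤ) (b : B → ℤ)
  (F : A → Series D N) (G : B → Series D N) e →
  mulS (λ u → ℤΣ.∑ xs (λ x → a x *ℤ F x u)) (λ v → ℤΣ.∑ ys (λ y → b y *ℤ G y v)) e ≡
  ℤΣ.∑ xs (λ x → ℤΣ.∑ ys (λ y → (a x *ℤ b y) *ℤ mulS (F x) (G y) e))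
mulS-∑ xs ys a b F G e = begin
  ℤΣ.∑ (splitsM e) (λ p → ℤΣ.∑ xs (λ x → a x *ℤ F x (proj₁ p)) *ℤ ℤΣ.∑ ys (λ y → b y *ℤ G y (proj₂ p)))
    ≡⟨ ℤΣ.∑-cong (splitsM e) (λ p → trans (ℤΣ.∑-*ʳ (ℤΣ.∑ ys (λ y → b y *ℤ G y (proj₂ p))) xs _)
         (ℤΣ.∑-cong xs (λ x → ℤΣ.∑-*ˡ (a x *ℤ F x (proj₁ p)) ys _))) ⟩
  ℤΣ.∑ (splitsM e) (λ p → ℤΣ.∑ xs (λ x → ℤΣ.∑ ys (λ y → term x y p)))
    ≡⟨ ℤΣ.∑-comm (splitsM e) xs _ ⟩
  ℤΣ.∑ xs (λ x → ℤΣ.∑ (splitsM e) (λ p → ℤΣ.∑ ys (λ y → term x y p)))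
    ≡⟨ ℤΣ.∑-cong xs (λ x → ℤΣ.∑-comm (splitsM e) ys _) ⟩
  ℤΣ.∑ xs (λ x → ℤΣ.∑ ys (λ y → ℤΣ.∑ (splitsM e) (term x y)))
    ≡⟨ ℤΣ.∑-cong xs (λ x → ℤΣ.∑-cong ys (λ y → trans
         (ℤΣ.∑-cong (splitsM e) (λ p → *ℤ-interchange (a x) (F x (proj₁ p)) (b y) (G y (proj₂ p))))
         (sym (ℤΣ.∑-*ˡ (a x *ℤ b y) (splitsM e) _)))) ⟩
  ℤΣ.∑ xs (λ x → ℤΣ.∑ ys (λ y → (a x *ℤ b y) *ℤ mulS (F x) (G y) e)) ∎
  where
  open ≡-Reasoning
  term : _ → _ → _ → ℤ
  term x y p = (a x *ℤ F x (proj₁ p)) *ℤ (b y *ℤ G y (proj₂ p))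
  *ℤ-interchange : ∀ p q r s → (p *ℤ q) *ℤ (r *ℤ s) ≡ (p *ℤ r) *ℤ (q *ℤ s)
  *ℤ-interchange = CommSemigroupProps.interchange ℤP.*-commutativeSemigroup

powSub-Hplus : ∀ k d {D N} (e : Mono D N) →
  powSub (suc k) (Hplus d) e ≡ ℤΣ.∑ (stackPartitions d) (λ σ → sign (area σ) *ℤ coeffM (σ ^ˢ suc k) e)
powSub-Hplus k d e = trans (powSub-∑ k (stackPartitions d) (sign ∘ area) coeffM e)
  (ℤΣ.∑-cong (stackPartitions d) (λ σ → cong (sign (area σ) *ℤ_) (powSub-coeffM k σ e)))

HplusSP-expansion : ∀ τ → All ((1 ≤_) ∘ proj₂) τ → ∀ {D N} (e : Mono D N) →
  HplusSP τ e ≡ ℤΣ.∑ (tuples τ) (λ σs → signOf σs *ℤ ∏M (powers τ σs) e)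
HplusSP-expansion [] [] e = sym (trans (ℤP.+-identityʳ _) (ℤP.*-identityˡ _))
HplusSP-expansion ((d , suc k) ∷ τ) (_ ∷ pτ) e = begin
  mulS (powSub (suc k) (Hplus d)) (HplusSP τ) e
    ≡⟨ mulS-cong (powSub-Hplus k d) (HplusSP-expansion τ pτ) e ⟩
  mulS (λ a → ℤΣ.∑ SPd (λ σ → sign (area σ) *ℤ coeffM (σ ^ˢ suc k) a))
       (λ b → ℤΣ.∑ (tuples τ) (λ σs → signOf σs *ℤ ∏M (powers τ σs) b)) e
    ≡⟨ mulS-∑ SPd (tuples τ) (sign ∘ area) signOf (λ σ → coeffM (σ ^ˢ suc k)) (∏M ∘ powers τ) e ⟩
  ℤΣ.∑ SPd (λ σ → ℤΣ.∑ (tuples τ) (λ σs →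
    (sign (area σ) *ℤ signOf σs) *ℤ mulS (coeffM (σ ^ˢ suc k)) (∏M (powers τ σs)) e))
    ≡⟨ ℤΣ.∑-cartesian-∷ SPd (map (λ { (d , m) → stackPartitions d }) τ) _ ⟨
  ℤΣ.∑ (tuples ((d , suc k) ∷ τ)) (λ σs → signOf σs *ℤ ∏M (powers ((d , suc k) ∷ τ) σs) e) ∎
  where
  open ≡-Reasoning
  SPd : List SP
  SPd = stackPartitions d

weight-↭ : ∀ {xs ys} → xs ↭ ys → weight xs ≡ weight ys
weight-↭ p = ℕLP.sum-↭ (Perm.map⁺ _ p)

weight-++ : ∀ xs ys → weight (xs ++ ys) ≡ weight xs + weight ys
weight-++ xs ys = trans (cong sum (LP.map-++ _ xs ys)) (ℕLP.sum-++ (map _ xs) _)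

weight-rowStacks : ∀ s r → weight (rowStacks s r) ≡ s * sum r
weight-rowStacks s r = trans (weight-map (nonzeros r)) (cong (s *_) (sum-nonzeros r))
  where
  weight-map : ∀ l → weight (map (s ,_) l) ≡ s * sum l
  weight-map [] = sym (ℕP.*-zeroʳ s)
  weight-map (x ∷ l) = trans (cong (_+_ (s * x)) (weight-map l)) (sym (ℕP.*-distribˡ-+ s x (sum l)))
  sum-nonzeros : ∀ r → sum (nonzeros r) ≡ sum r
  sum-nonzeros [] = refl
  sum-nonzeros (zero ∷ r) = sum-nonzeros r
  sum-nonzeros (suc k ∷ r) = cong (_+_ (suc k)) (sum-nonzeros r)

rowsWeight : ∀ {D N} → ℕ → Mono D N → ℕ
rowsWeight s e = weight (stacksFrom s (rows e))

rowsWeight-∷ : ∀ {D N} s (r : Vec ℕ N) (e : Mono D N) →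
  rowsWeight s (r V.∷ e) ≡ s * sum (V.toList r) + rowsWeight (suc s) e
rowsWeight-∷ s r e = trans (weight-++ (rowStacks s (V.toList r)) _)
                           (cong (_+ rowsWeight (suc s) e) (weight-rowStacks s (V.toList r)))

splitsV-sum : ∀ {N} (r : Vec ℕ N) →
  All (λ p → sum (V.toList (proj₁ p)) + sum (V.toList (proj₂ p)) ≡ sum (V.toList r)) (splitsV r)
splitsV-sum V.[] = refl ∷ []
splitsV-sum (k V.∷ v) = AllP.concat⁺ (AllP.map⁺ (All.tabulate (λ {i} i∈ →
  AllP.map⁺ (All.map (λ {p} h → step i p (ℕP.≤-pred (All.lookup (AllP.all-upTo (suc k)) i∈)) h) (splitsV-sum v)))))
  where
  step : ∀ i p → i ≤ k → sum (V.toList (proj₁ p)) + sum (V.toList (proj₂ p)) ≡ sum (V.toList v) →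
         (i + sum (V.toList (proj₁ p))) + ((k ∸ i) + sum (V.toList (proj₂ p))) ≡ k + sum (V.toList v)
  step i p i≤k h = trans (+-interchange i _ (k ∸ i) _) (cong₂ _+_ (ℕP.m+[n∸m]≡n i≤k) h)

splitsM-rowsWeight : ∀ {D N} s (e : Mono D N) →
  All (λ p → rowsWeight s (proj₁ p) + rowsWeight s (proj₂ p) ≡ rowsWeight s e) (splitsM e)
splitsM-rowsWeight s V.[] = refl ∷ []
splitsM-rowsWeight s (r V.∷ e) = AllP.concat⁺ (AllP.map⁺ (All.map (λ {p} hp →
  AllP.map⁺ (All.map (λ {q} hq → step p q hp hq) (splitsM-rowsWeight (suc s) e))) (splitsV-sum r)))
  where
  step : ∀ p q → sum (V.toList (proj₁ p)) + sum (V.toList (proj₂ p)) ≡ sum (V.toList r) →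
         rowsWeight (suc s) (proj₁ q) + rowsWeight (suc s) (proj₂ q) ≡ rowsWeight (suc s) e →
         rowsWeight s (proj₁ p V.∷ proj₁ q) + rowsWeight s (proj₂ p V.∷ proj₂ q) ≡ rowsWeight s (r V.∷ e)
  step p q hp hq = begin
    rowsWeight s (proj₁ p V.∷ proj₁ q) + rowsWeight s (proj₂ p V.∷ proj₂ q)
      ≡⟨ cong₂ _+_ (rowsWeight-∷ s (proj₁ p) (proj₁ q)) (rowsWeight-∷ s (proj₂ p) (proj₂ q)) ⟩
    (s * sum (V.toList (proj₁ p)) + rowsWeight (suc s) (proj₁ q)) + (s * sum (V.toList (proj₂ p)) + rowsWeight (suc s) (proj₂ q))
      ≡⟨ +-interchange (s * sum (V.toList (proj₁ p))) (rowsWeight (suc s) (proj₁ q)) (s * sum (V.toList (proj₂ p))) _ ⟩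
    (s * sum (V.toList (proj₁ p)) + s * sum (V.toList (proj₂ p))) + (rowsWeight (suc s) (proj₁ q) + rowsWeight (suc s) (proj₂ q))
      ≡⟨ cong₂ _+_ (trans (sym (ℕP.*-distribˡ-+ s _ _)) (cong (s *_) hp)) hq ⟩
    s * sum (V.toList r) + rowsWeight (suc s) e
      ≡⟨ rowsWeight-∷ s r e ⟨
    rowsWeight s (r V.∷ e) ∎
    where open ≡-Reasoning

weight-monoType : ∀ {D N} (e : Mono D N) → weight (monoType e) ≡ rowsWeight 1 e
weight-monoType e = weight-↭ (monoType-↭ e)

allZero⇒rowsWeight≡0 : ∀ {D N} s (e : Mono D N) → T (allZero e) → rowsWeight s e ≡ 0
allZero⇒rowsWeight≡0 s V.[] _ = refl
allZero⇒rowsWeight≡0 s (r V.∷ e) h = let (hr , he) = T-∧⁻ h in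
  trans (rowsWeight-∷ s r e) (cong₂ _+_ (trans (cong (s *_) (sum-zeros (V.toList r) hr)) (ℕP.*-zeroʳ s))
                                         (allZero⇒rowsWeight≡0 (suc s) e he))
  where
  sum-zeros : ∀ l → T (Bool.all (_≡ᵇ 0) l) → sum l ≡ 0
  sum-zeros [] _ = refl
  sum-zeros (zero ∷ l) h = sum-zeros l h

∏M-vanishes : ∀ {D N} βs (e : Mono D N) → weight (monoType e) ≢ sum (map weight βs) → ∏M βs e ≡ + 0
∏M-vanishes [] e w≢0 with T? (allZero e)
... | yes h = ⊥-elim (w≢0 (trans (weight-monoType e) (allZero⇒rowsWeight≡0 1 e h)))
... | no ¬h rewrite ¬T⇒≡false ¬h = refl
∏M-vanishes (β ∷ βs) e w≢ =
  trans (ℤΣ.∑-cong-All (splitsM-rowsWeight 1 e) (λ {p} → term p)) (ℤΣ.∑-zero (splitsM e) (λ _ → refl))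
  where
  term : ∀ p → rowsWeight 1 (proj₁ p) + rowsWeight 1 (proj₂ p) ≡ rowsWeight 1 e →
         coeffM β (proj₁ p) *ℤ ∏M βs (proj₂ p) ≡ + 0
  term p hp with monoType (proj₁ p) ==SP β in eq
  ... | false = refl
  ... | true = trans (ℤP.*-identityˡ _) (∏M-vanishes βs (proj₂ p) λ w₂ → w≢ (begin
    weight (monoType e)                                 ≡⟨ weight-monoType e ⟩
    rowsWeight 1 e                                      ≡⟨ hp ⟨
    rowsWeight 1 (proj₁ p) + rowsWeight 1 (proj₂ p)     ≡⟨ cong₂ _+_ (weight-monoType (proj₁ p)) (weight-monoType (proj₂ p)) ⟨
    weight (monoType (proj₁ p)) + weight (monoType (proj₂ p)) ≡⟨ cong₂ _+_ (cong weight (==SP⇒≡ (≡true⇒T eq))) w₂ ⟩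
    weight β + sum (map weight βs) ∎))
    where open ≡-Reasoning

sortedDesc-scale : ∀ m {σ} → T (sortedDesc σ) → T (sortedDesc (map (scale m) σ))
sortedDesc-scale m {σ} h =
  Sorted⇒sortedDesc (SP↓.Sorted-map (scale m) (λ {x} {y} → scale-mono m x y) (sortedDesc⇒Sorted {σ} h))

Positive-scale : ∀ k {σ} → Positive σ → Positive (map (scale (suc k)) σ)
Positive-scale k pσ = AllP.map⁺ (All.map (λ { (1≤d , 1≤j) → 1≤d , ℕP.≤-trans 1≤j (ℕP.m≤m+n _ _) }) pσ)

weight-scale : ∀ m σ → weight (map (scale m) σ) ≡ m * weight σ
weight-scale m [] = sym (ℕP.*-zeroʳ m)
weight-scale m ((d , j) ∷ σ) =
  trans (cong₂ _+_ (x*[y*z]≡y*[x*z] d m j) (weight-scale m σ)) (sym (ℕP.*-distribˡ-+ m (d * j) _))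

ValidPowers : SP → List SP → Set
ValidPowers τ σs = All SortedPositive (powers τ σs) × sum (map weight (powers τ σs)) ≡ weight τ

tuples-ValidPowers : ∀ τ → All ((1 ≤_) ∘ proj₂) τ → All (ValidPowers τ) (tuples τ)
tuples-ValidPowers [] [] = ([] , refl) ∷ []
tuples-ValidPowers ((d , suc k) ∷ τ) (_ ∷ pτ) = AllP.concat⁺ (AllP.map⁺ (All.map (λ {σ} σ⊩d →
    AllP.map⁺ (All.map (λ {σs} → step σ σs σ⊩d) (tuples-ValidPowers τ pτ)))
  (AllP.all-filter (T? ∘ isStackPartition d) (concatMap (λ k → listsOfLength k (stacksUpTo d)) (upTo (suc d))))))
  where
  step : ∀ σ σs → T (isStackPartition d σ) → ValidPowers τ σs → ValidPowers ((d , suc k) ∷ τ) (σ ∷ σs)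
  step σ σs σ⊩d (spσs , w) =
    ((sortedDesc-scale (suc k) {σ} (stackPartition-sortedDesc d σ σ⊩d) , Positive-scale k (stackPartition-Positive d σ σ⊩d))
      ∷ spσs) ,
    cong₂ _+_ (trans (weight-scale (suc k) σ) (trans (cong (suc k *_) (stackPartition-weight d σ σ⊩d)) (ℕP.*-comm (suc k) d)))
              w

-- Enumerating stack partitions

_==ˢ_ : Stack → Stack → Bool
(d , m) ==ˢ (d' , m') = (d ≡ᵇ d') ∧ (m ≡ᵇ m')

==SP-∷ : ∀ x xs y ys → ((x ∷ xs) ==SP (y ∷ ys)) ≡ (x ==ˢ y) ∧ (xs ==SP ys)
==SP-∷ (d , m) xs (d' , m') ys = T-ext
  (λ h → let eq = ==SP⇒≡ {(d , m) ∷ xs} {(d' , m') ∷ ys} h ; x≡y = LP.∷-injectiveˡ eq in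
         T-∧⁺ (T-∧⁺ (ℕP.≡⇒≡ᵇ d d' (cong proj₁ x≡y)) (ℕP.≡⇒≡ᵇ m m' (cong proj₂ x≡y))) (≡⇒==SP (LP.∷-injectiveʳ eq)))
  (λ h → let (x==y , xs==ys) = T-∧⁻ h ; (d≡d' , m≡m') = T-∧⁻ x==y in
         ≡⇒==SP (cong₂ _∷_ (cong₂ _,_ (ℕP.≡ᵇ⇒≡ d d' d≡d') (ℕP.≡ᵇ⇒≡ m m' m≡m')) (==SP⇒≡ xs==ys)))

count : SP → List SP → ℕ
count t xs = ∑ xs (λ α → ind (t ==SP α))

∑-pick : ∀ t xs (f : SP → ℤ) → ℤΣ.∑ xs (λ α → f α *ℤ + ind (t ==SP α)) ≡ f t *ℤ + count t xs
∑-pick t [] f = sym (ℤP.*-zeroʳ (f t))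
∑-pick t (α ∷ xs) f with t ==SP α in eq
... | true with ==SP⇒≡ {t} {α} (≡true⇒T eq)
...   | refl = trans (cong (f t *ℤ + 1 +ℤ_) (∑-pick t xs f))
                     (trans (sym (ℤP.*-distribˡ-+ (f t) (+ 1) _)) (cong (f t *ℤ_) (sym (ℤP.pos-+ 1 (count t xs)))))
∑-pick t (α ∷ xs) f | false = trans (cong₂ _+ℤ_ (ℤP.*-zeroʳ (f α)) (∑-pick t xs f)) (ℤP.+-identityˡ _)

count-filterᵇ : ∀ t p xs → count t (filterᵇ p xs) ≡ ind (p t) * count t xs
count-filterᵇ t p xs = trans (ℕΣ.∑-filterᵇ p xs _) (trans (ℕΣ.∑-cong xs term) (sym (ℕΣ.∑-*ˡ (ind (p t)) xs _)))
  where
  term : ∀ α → (if p α then ind (t ==SP α) else 0) ≡ ind (p t) * ind (t ==SP α)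
  term α with t ==SP α in eq
  ... | true rewrite ==SP⇒≡ {t} {α} (≡true⇒T eq) = trans (if-then-0 (p α) 1) refl
  ... | false = trans (if-then-0 (p α) 0) (trans (ℕP.*-zeroʳ (ind (p α))) (sym (ℕP.*-zeroʳ (ind (p t)))))

count-listsOfLength : ∀ S k t → All (λ x → ∑ S (λ y → ind (x ==ˢ y)) ≡ 1) t →
                      count t (listsOfLength k S) ≡ ind (length t ≡ᵇ k)
count-listsOfLength S zero [] _ = refl
count-listsOfLength S zero (y ∷ t) _ = cong (λ b → ind b + 0) (¬T⇒≡false (λ h → case-[] (==SP⇒≡ {y ∷ t} {[]} h)))
  where
  case-[] : ∀ {A : Set} {x : A} {xs : List A} → x ∷ xs ≢ []
  case-[] ()
count-listsOfLength S (suc k) [] _ =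
  trans (ℕΣ.∑-listsOfLength-suc k S _) (ℕΣ.∑-zero S (λ i → ℕΣ.∑-zero (listsOfLength k S) (λ _ → refl)))
count-listsOfLength S (suc k) (y ∷ t) (y-once ∷ t-once) = begin
  count (y ∷ t) (listsOfLength (suc k) S)
    ≡⟨ ℕΣ.∑-listsOfLength-suc k S _ ⟩
  ∑ S (λ x → ∑ (listsOfLength k S) (λ l → ind ((y ∷ t) ==SP (x ∷ l))))
    ≡⟨ ℕΣ.∑-cong S (λ x → trans
         (ℕΣ.∑-cong (listsOfLength k S) (λ l → trans (cong ind (==SP-∷ y t x l)) (ind-∧ (y ==ˢ x) _)))
         (sym (ℕΣ.∑-*ˡ (ind (y ==ˢ x)) (listsOfLength k S) _))) ⟩
  ∑ S (λ x → ind (y ==ˢ x) * count t (listsOfLength k S))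
    ≡⟨ ℕΣ.∑-*ʳ _ S _ ⟨
  ∑ S (λ x → ind (y ==ˢ x)) * count t (listsOfLength k S)
    ≡⟨ cong₂ _*_ y-once (count-listsOfLength S k t t-once) ⟩
  1 * ind (length t ≡ᵇ k)
    ≡⟨ ℕP.*-identityˡ _ ⟩
  ind (length (y ∷ t) ≡ᵇ suc k) ∎
  where open ≡-Reasoning

∑-upTo-≡ᵇ : ∀ x n → ∑ (upTo n) (λ j → ind (x ≡ᵇ j)) ≡ ind (x <ᵇ n)
∑-upTo-≡ᵇ x zero = refl
∑-upTo-≡ᵇ x (suc n) = trans (∑-upTo-suc n _) (trans (cong (_+ ind (x ≡ᵇ n)) (∑-upTo-≡ᵇ x n)) (split (ℕP.<-cmp x n)))
  where
  split : Tri (x < n) (x ≡ n) (n < x) → ind (x <ᵇ n) + ind (x ≡ᵇ n) ≡ ind (x <ᵇ suc n)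
  split (tri< x<n x≢n _)
    rewrite T⇒≡true (ℕP.<⇒<ᵇ x<n) | ¬T⇒≡false (x≢n ∘ ℕP.≡ᵇ⇒≡ x n) | T⇒≡true (ℕP.<⇒<ᵇ (ℕP.m<n⇒m<1+n x<n)) = refl
  split (tri≈ x≮n x≡n _)
    rewrite ¬T⇒≡false (x≮n ∘ ℕP.<ᵇ⇒< x n) | T⇒≡true (ℕP.≡⇒≡ᵇ x n x≡n)
          | T⇒≡true (ℕP.<⇒<ᵇ (subst (_< suc n) (sym x≡n) (ℕP.n<1+n n))) = refl
  split (tri> x≮n x≢n n<x)
    rewrite ¬T⇒≡false (x≮n ∘ ℕP.<ᵇ⇒< x n) | ¬T⇒≡false (x≢n ∘ ℕP.≡ᵇ⇒≡ x n)
          | ¬T⇒≡false (λ h → ℕP.<⇒≱ n<x (ℕP.≤-pred (ℕP.<ᵇ⇒< x (suc n) h))) = refl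

∑-upTo1-≡ᵇ : ∀ x n → 1 ≤ x → x ≤ n → ∑ (upTo1 n) (λ j → ind (x ≡ᵇ j)) ≡ 1
∑-upTo1-≡ᵇ (suc x) n _ x<n = trans (ℕΣ.∑-map suc (upTo n) _) (trans (∑-upTo-≡ᵇ x n) (cong ind (T⇒≡true (ℕP.<⇒<ᵇ x<n))))

count-stacksUpTo : ∀ n d m → 1 ≤ d → d ≤ n → 1 ≤ m → m ≤ n → ∑ (stacksUpTo n) (λ y → ind ((d , m) ==ˢ y)) ≡ 1
count-stacksUpTo n d m 1≤d d≤n 1≤m m≤n = begin
  ∑ (stacksUpTo n) (λ y → ind ((d , m) ==ˢ y))
    ≡⟨ ℕΣ.∑-concatMap _ (upTo1 n) _ ⟩
  ∑ (upTo1 n) (λ d' → ∑ (map (d' ,_) (upTo1 n)) (λ y → ind ((d , m) ==ˢ y)))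
    ≡⟨ ℕΣ.∑-cong (upTo1 n) (λ d' → trans (ℕΣ.∑-map (d' ,_) (upTo1 n) _) (trans
         (ℕΣ.∑-cong (upTo1 n) (λ m' → ind-∧ (d ≡ᵇ d') (m ≡ᵇ m'))) (sym (ℕΣ.∑-*ˡ (ind (d ≡ᵇ d')) (upTo1 n) _)))) ⟩
  ∑ (upTo1 n) (λ d' → ind (d ≡ᵇ d') * ∑ (upTo1 n) (λ m' → ind (m ≡ᵇ m')))
    ≡⟨ ℕΣ.∑-*ʳ _ (upTo1 n) _ ⟨
  ∑ (upTo1 n) (λ d' → ind (d ≡ᵇ d')) * ∑ (upTo1 n) (λ m' → ind (m ≡ᵇ m'))
    ≡⟨ cong₂ _*_ (∑-upTo1-≡ᵇ d n 1≤d d≤n) (∑-upTo1-≡ᵇ m n 1≤m m≤n) ⟩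
  1 ∎
  where open ≡-Reasoning

length≤weight : ∀ {t} → Positive t → length t ≤ weight t
length≤weight [] = z≤n
length≤weight ((1≤d , 1≤m) ∷ pt) = ℕP.+-mono-≤ (ℕP.*-mono-≤ 1≤d 1≤m) (length≤weight pt)

count-stackPartitions : ∀ n t → count t (stackPartitions n) ≡ ind (isStackPartition n t)
count-stackPartitions n t =
  trans (count-filterᵇ t (isStackPartition n) candidates) (by-cases (T? (isStackPartition n t)))
  where
  candidates : List SP
  candidates = concatMap (λ k → listsOfLength k (stacksUpTo n)) (upTo (suc n))
  count-candidates : T (isStackPartition n t) → count t candidates ≡ 1
  count-candidates t⊩n = begin
    count t candidates
      ≡⟨ ℕΣ.∑-concatMap (λ k → listsOfLength k (stacksUpTo n)) (upTo (suc n)) _ ⟩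
    ∑ (upTo (suc n)) (λ k → count t (listsOfLength k (stacksUpTo n)))
      ≡⟨ ℕΣ.∑-cong (upTo (suc n)) (λ k → count-listsOfLength (stacksUpTo n) k t (All.map once stack≤n)) ⟩
    ∑ (upTo (suc n)) (λ k → ind (length t ≡ᵇ k))
      ≡⟨ ∑-upTo-≡ᵇ (length t) (suc n) ⟩
    ind (length t <ᵇ suc n)
      ≡⟨ cong ind (T⇒≡true (ℕP.<⇒<ᵇ (s≤s (subst (length t ≤_) (stackPartition-weight n t t⊩n)
                                                 (length≤weight (stackPartition-Positive n t t⊩n)))))) ⟩
    1 ∎
    where
    open ≡-Reasoning
    stack≤n : All (λ x → (1 ≤ proj₁ x × 1 ≤ proj₂ x) × proj₁ x * proj₂ x ≤ n) t
    stack≤n = All.zip (stackPartition-Positive n t t⊩n ,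
      subst (λ w → All (λ x → proj₁ x * proj₂ x ≤ w) t) (stackPartition-weight n t t⊩n) (AllP.map⁻ (All-≤-sum (map _ t))))
    once : ∀ {x} → (1 ≤ proj₁ x × 1 ≤ proj₂ x) × proj₁ x * proj₂ x ≤ n → ∑ (stacksUpTo n) (λ y → ind (x ==ˢ y)) ≡ 1
    once {d , m} ((1≤d , 1≤m) , dm≤n) = count-stacksUpTo n d m
      1≤d (ℕP.≤-trans (ℕP.m≤m*n d m {{ℕ.>-nonZero 1≤m}}) dm≤n) 1≤m (ℕP.≤-trans (ℕP.m≤n*m m d {{ℕ.>-nonZero 1≤d}}) dm≤n)
  by-cases : Dec (T (isStackPartition n t)) →
             ind (isStackPartition n t) * count t candidates ≡ ind (isStackPartition n t)
  by-cases (no ¬t⊩n) rewrite ¬T⇒≡false ¬t⊩n = refl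
  by-cases (yes t⊩n) rewrite T⇒≡true t⊩n = trans (ℕP.+-identityʳ _) (count-candidates t⊩n)

∑-coeffM : ∀ n (f : SP → ℤ) {D N} (e : Mono D N) →
  ℤΣ.∑ (stackPartitions n) (λ α → f α *ℤ coeffM α e) ≡ f (monoType e) *ℤ + ind (isStackPartition n (monoType e))
∑-coeffM n f e = trans (ℤΣ.∑-cong (stackPartitions n) (λ α → cong (f α *ℤ_) (indℤ (monoType e ==SP α))))
  (trans (∑-pick (monoType e) (stackPartitions n) f)
         (cong (λ c → f (monoType e) *ℤ + c) (count-stackPartitions n (monoType e))))

∏M≡calS-when-⊩ : ∀ n βs → All SortedPositive βs → sum (map weight βs) ≡ n → ∀ {D N} (e : Mono D N) →
  ∏M βs e ≡ + calS (monoType e) βs *ℤ + ind (isStackPartition n (monoType e))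
∏M≡calS-when-⊩ n βs spβs w≡n e rewrite isStackPartition-monoType n e with T? (weight (monoType e) ≡ᵇ n)
... | yes e⊩n rewrite T⇒≡true e⊩n = trans (∏M≡calS spβs e) (sym (ℤP.*-identityʳ _))
... | no ¬e⊩n rewrite ¬T⇒≡false ¬e⊩n =
  trans (∏M-vanishes βs e (λ w≡ → ¬e⊩n (ℕP.≡⇒≡ᵇ _ n (trans w≡ w≡n)))) (sym (ℤP.*-zeroʳ (+ calS (monoType e) βs)))

mainTheorem20 : (n : ℕ) (τ : SP) → T (isStackPartition n τ) →
    (D N : ℕ) (e : Mono D N) →
    HplusSP τ e ≡ sumℤ (map (λ α → HS τ α *ℤ coeffM α e) (stackPartitions n))
mainTheorem20 n τ τ⊩n D N e = begin
  HplusSP τ e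
    ≡⟨ HplusSP-expansion τ multiplicities-positive e ⟩
  ℤΣ.∑ (tuples τ) (λ σs → signOf σs *ℤ ∏M (powers τ σs) e)
    ≡⟨ ℤΣ.∑-cong-All (tuples-ValidPowers τ multiplicities-positive) (λ { {σs} (spσs , w) →
         cong (signOf σs *ℤ_) (∏M≡calS-when-⊩ n (powers τ σs) spσs (trans w (stackPartition-weight n τ τ⊩n)) e) }) ⟩
  ℤΣ.∑ (tuples τ) (λ σs → signOf σs *ℤ (+ calS α (powers τ σs) *ℤ c))
    ≡⟨ ℤΣ.∑-cong (tuples τ) (λ σs → sym (ℤP.*-assoc (signOf σs) _ c)) ⟩
  ℤΣ.∑ (tuples τ) (λ σs → (signOf σs *ℤ + calS α (powers τ σs)) *ℤ c)
    ≡⟨ ℤΣ.∑-*ʳ c (tuples τ) _ ⟨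
  HS τ α *ℤ c
    ≡⟨ ∑-coeffM n (HS τ) e ⟨
  sumℤ (map (λ α → HS τ α *ℤ coeffM α e) (stackPartitions n)) ∎
  where
  open ≡-Reasoning
  α : SP
  α = monoType e
  c : ℤ
  c = + ind (isStackPartition n α)
  multiplicities-positive : All ((1 ≤_) ∘ proj₂) τ
  multiplicities-positive = All.map proj₂ (stackPartition-Positive n τ τ⊩n)
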